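{- Let $X$ be a closed polygon of the $n$-th Schreier graph $\Sigma_n$ of the Basilica group chosen uniformly at random, and for $w\in\{a,b\}$ let $w_n$ be the number of edges of $X$ labeled $w$, with mean $\mu_{n,w}$ and variance $\sigma^2_{n,w}$. For $n\geq5$ odd: $\mu_{n,a}=2^{n-2}$, $\sigma^2_{n,a}=(n+1)2^{n-4}$, $\mu_{n,b}=2^{n-1}$, $\sigma^2_{n,b}=(n+3)2^{n-3}$. For $n\geq 4$ even: $\mu_{n,a}=2^{n-2}$, $\sigma^2_{n,a}=(n+2)2^{n-4}$, $\mu_{n,b}=2^{n-1}$, $\sigma^2_{n,b}=(n+2)2^{n-3}$.
   Context: Automorphisms of the rooted binary tree (vertices = finite words over $\{0,1\}$) are written $g=\tau(g_0,g_1)$, meaning $g(xw)=\tau(x)g_x(w)$. The Basilica group is generated by $a$ and $b$ with $a(0w)=0b(w)$, $a(1w)=1w$, $b(0w)=1a(w)$, $b(1w)=0w$. Its $n$-th Schreier graph $\Sigma_n$ has vertex set the $2^n$ words of length $n$; for each $s\in\{a,b\}$ and each vertex $u$ with $s(u)\neq u$ there is one edge joining $u$ and $s(u)$, labeled $s$ (double edges may occur); loops are erased. A closed polygon is a subset of the edge set in which every vertex has even degree (empty set included). -}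

module Defs where

open import Data.Bool using (Bool; true; false; if_then_else_)
open import Data.Nat using (ℕ; zero; suc; _+_; _%_) renaming (_*_ to _ℕ*_)
open import Data.Nat.Properties using (_≟_)
open import Data.List using (List; []; _∷_; map; filter; length; concatMap; zip; _++_)
open import Data.Nat.ListAction using (sum)
open import Data.List.Relation.Unary.All using (All; all?)
open import Data.Vec using (Vec; []; _∷_; toList)
import Data.Vec.Properties as VecP
import Data.Bool.Properties as BoolP
open import Data.Product using (_×_; _,_; proj₁; proj₂)
open import Data.Sum using (_⊎_)
open import Data.Integer using (+_)
open import Data.Rational using (ℚ; _/_; _-_; _*_; 0ℚ)
open import Relation.Binary.PropositionalEquality using (_≡_; _≢_; refl)
open import Relation.Nullary using (Dec; yes; no; ¬?)
open import Relation.Nullary.Decidable using (_⊎-dec_)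

data Gen : Set where
  a b : Gen

allGens : List Gen
allGens = a ∷ b ∷ []

gen-≟ : (s t : Gen) → Dec (s ≡ t)
gen-≟ a a = yes refl
gen-≟ a b = no (λ ())
gen-≟ b a = no (λ ())
gen-≟ b b = yes refl

-- Vertices of Σ_n: words of length n over {0,1}  (false = 0, true = 1)
Word : ℕ → Set
Word n = Vec Bool n

act : Gen → {n : ℕ} → Word n → Word n
act s [] = []
act a (false ∷ w) = false ∷ act b w
act a (true ∷ w) = true ∷ w
act b (false ∷ w) = true ∷ act a w
act b (true ∷ w) = false ∷ w

word-≟ : {n : ℕ} (u v : Word n) → Dec (u ≡ v)
word-≟ = VecP.≡-dec BoolP._≟_

allWords : (n : ℕ) → List (Word n)
allWords zero = [] ∷ []
allWords (suc n) = map (false ∷_) (allWords n) ++ map (true ∷_) (allWords n)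

-- Edges of Σ_n: one edge (s , u), joining u and s(u), for each generator s
-- and each vertex u with s(u) ≠ u (loops erased; double edges kept).
Edge : ℕ → Set
Edge n = Gen × Word n

edges : (n : ℕ) → List (Edge n)
edges n = filter (λ e → ¬? (word-≟ (act (proj₁ e) (proj₂ e)) (proj₂ e)))
                 (concatMap (λ s → map (s ,_) (allWords n)) allGens)

label : {n : ℕ} → Edge n → Gen
label = proj₁

Incident : {n : ℕ} → Word n → Edge n → Set
Incident v (s , u) = (u ≡ v) ⊎ (act s u ≡ v)

incident? : {n : ℕ} (v : Word n) (e : Edge n) → Dec (Incident v e)
incident? v (s , u) = word-≟ u v ⊎-dec word-≟ (act s u) v

-- A subset of the edge set of Σ_n, as a characteristic vector indexed by
-- the (fixed, duplicate-free) list of edges.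
EdgeSubset : ℕ → Set
EdgeSubset n = Vec Bool (length (edges n))

selected : {n : ℕ} → EdgeSubset n → List (Edge n)
selected {n} X = map proj₁
  (filter (λ p → proj₂ p BoolP.≟ true) (zip (edges n) (toList X)))

degree : {n : ℕ} → Word n → EdgeSubset n → ℕ
degree {n} v X = length (filter (incident? v) (selected {n} X))

IsClosedPolygon : {n : ℕ} → EdgeSubset n → Set
IsClosedPolygon {n} X = All (λ v → degree {n} v X % 2 ≡ 0) (allWords n)

isClosedPolygon? : {n : ℕ} (X : EdgeSubset n) → Dec (IsClosedPolygon X)
isClosedPolygon? {n} X = all? (λ v → degree {n} v X % 2 ≟ 0) (allWords n)

allSubsets : (m : ℕ) → List (Vec Bool m)
allSubsets = allWords

closedPolygons : (n : ℕ) → List (EdgeSubset n)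
closedPolygons n = filter (isClosedPolygon? {n}) (allSubsets (length (edges n)))

labelCount : {n : ℕ} → Gen → EdgeSubset n → ℕ
labelCount {n} w X = length (filter (λ e → gen-≟ (label e) w) (selected {n} X))

-- mean of the uniform distribution on a (nonempty) list of values
-- (the empty list, which never occurs below, is assigned 0)
average : List ℕ → ℚ
average [] = 0ℚ
average (x ∷ xs) = (+ sum (x ∷ xs)) / suc (length xs)

variance : List ℕ → ℚ
variance ys = average (map (λ y → y ℕ* y) ys) - average ys * average ys

μ : ℕ → Gen → ℚ
μ n w = average (map (labelCount {n} w) (closedPolygons n))

σ² : ℕ → Gen → ℚ
σ² n w = variance (map (labelCount {n} w) (closedPolygons n))

ℕtoℚ : ℕ → ℚ
ℕtoℚ k = + k / 1

-- A closed polygon of Σ_{m+2} consists of a set X₁ of a-edges (at the words 0u), a set X₂ of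
-- b-edges at the words 0u and a set X₃ of b-edges at the words 1u.  Even degree at the vertices
-- 1w forces X₃ = X₂ ∘ a⁻¹, so X₃ is determined and the b-count is 2|X₂|.  Splitting X₂ into its
-- part P on the words moved by a and its part R on the 2^m words fixed by a, the parity conditions
-- at the vertices 0w are exactly those of the closed polygon of Σ_{m+1} with a-edges P and b-edges
-- X₁, while R is free.  So a polygon of Σ_{m+1} with counts (p, q) accounts for the polygons of
-- Σ_{m+2} with counts (q, 2 (p + |R|)), R ranging over all sets of a-fixed words.  This gives
-- linear recurrences for the number N of polygons and the sums of a, a², b, b² over them, whose
-- solution is: with x = 2^n, 4 Σa = N x, 2 Σb = N x, 16 Σa² = N (x² + α x), 8 Σb² = N (2x² + β x),
-- where (α, β) = (4, 4) for n = 2 and (α, β) ↦ (β, α + 2) at each step.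

module Submission where

open import Defs
open import Data.Bool using (Bool; true; false; if_then_else_; not; _∧_; _∨_; _xor_)
open import Data.Bool.Properties
  using (∨-assoc; ∨-zeroʳ; ∨-identityʳ; ∨-idem; ∧-assoc; not-injective; xor-comm; xor-same; xor-identityʳ)
  renaming (_≟_ to _≟ᵇ_)
open import Data.Nat using (ℕ; zero; suc; _+_; _*_; _%_; _^_; _∸_; _≤_; s≤s)
open import Data.Nat.Properties
  using (_≟_; +-assoc; +-comm; +-identityʳ; *-identityʳ; *-zeroʳ; *-comm; *-distribˡ-+;
         *-cancelˡ-≡; suc-injective; +-commutativeSemigroup)
open import Algebra.Properties.CommutativeSemigroup +-commutativeSemigroup
  using () renaming (interchange to +-interchange; x∙yz≈y∙xz to +-leftComm)
open import Data.Nat.ListAction using (sum)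
open import Data.Nat.ListAction.Properties using (sum-++)
open import Data.Nat.Tactic.RingSolver using (solve-∀)
open import Data.List using (List; []; _∷_; map; filter; length; _++_; zip)
open import Data.Bool.ListAction using (all)
open import Data.List.Properties using (map-++; map-∘; length-map; length-++; ++-identityʳ; filter-++)
open import Data.List.Relation.Unary.All using (all?)
open import Data.Vec using (Vec; []; _∷_; toList)
open import Data.Product using (_×_; _,_; proj₁; proj₂; ∃)
open import Data.Unit using (⊤; tt)
open import Function using (_∘_)
open import Relation.Binary.PropositionalEquality
open import Relation.Nullary using (does; ¬?)
open import Relation.Unary using (Decidable)
import Data.Integer as ℤ
import Data.Integer.Properties as ℤ
import Data.Integer.Tactic.RingSolver as ℤ
import Data.Rational as ℚ
import Data.Rational.Properties as ℚ
import Data.Rational.Unnormalised as ℚᵘ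
import Data.Rational.Unnormalised.Properties as ℚᵘ

sumSubsets : (m : ℕ) → (Vec Bool m → ℕ) → ℕ
sumSubsets zero    G = G []
sumSubsets (suc m) G = sumSubsets m (λ X → G (false ∷ X)) + sumSubsets m (λ X → G (true ∷ X))

sum-allWords : ∀ m (G : Vec Bool m → ℕ) → sum (map G (allWords m)) ≡ sumSubsets m G
sum-allWords zero    G = +-identityʳ (G [])
sum-allWords (suc m) G = begin
    sum (map G (map (false ∷_) W ++ map (true ∷_) W))
  ≡⟨ cong sum (map-++ G (map (false ∷_) W) _) ⟩
    sum (map G (map (false ∷_) W) ++ map G (map (true ∷_) W))
  ≡⟨ sum-++ (map G (map (false ∷_) W)) _ ⟩
    sum (map G (map (false ∷_) W)) + sum (map G (map (true ∷_) W))
  ≡⟨ cong₂ _+_ (trans (cong sum (sym (map-∘ W))) (sum-allWords m _))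
               (trans (cong sum (sym (map-∘ W))) (sum-allWords m _)) ⟩
    sumSubsets (suc m) G ∎
  where
  open ≡-Reasoning
  W = allWords m

sumSubsets-cong : ∀ m {G H : Vec Bool m → ℕ} → (∀ X → G X ≡ H X) → sumSubsets m G ≡ sumSubsets m H
sumSubsets-cong zero    G≡H = G≡H []
sumSubsets-cong (suc m) G≡H =
  cong₂ _+_ (sumSubsets-cong m (λ X → G≡H (false ∷ X))) (sumSubsets-cong m (λ X → G≡H (true ∷ X)))

sumSubsets-+ : ∀ m (G H : Vec Bool m → ℕ) →
  sumSubsets m (λ X → G X + H X) ≡ sumSubsets m G + sumSubsets m H
sumSubsets-+ zero    G H = refl
sumSubsets-+ (suc m) G H = trans
  (cong₂ _+_ (sumSubsets-+ m (λ X → G (false ∷ X)) (λ X → H (false ∷ X)))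
             (sumSubsets-+ m (λ X → G (true ∷ X)) (λ X → H (true ∷ X))))
  (+-interchange (sumSubsets m (λ X → G (false ∷ X))) (sumSubsets m (λ X → H (false ∷ X)))
                 (sumSubsets m (λ X → G (true ∷ X))) (sumSubsets m (λ X → H (true ∷ X))))

sumSubsets-* : ∀ m k (G : Vec Bool m → ℕ) → sumSubsets m (λ X → k * G X) ≡ k * sumSubsets m G
sumSubsets-* zero    k G = refl
sumSubsets-* (suc m) k G = trans
  (cong₂ _+_ (sumSubsets-* m k (λ X → G (false ∷ X))) (sumSubsets-* m k (λ X → G (true ∷ X))))
  (sym (*-distribˡ-+ k _ _))

sumSubsets-0 : ∀ m → sumSubsets m (λ _ → 0) ≡ 0
sumSubsets-0 zero    = refl
sumSubsets-0 (suc m) = cong₂ _+_ (sumSubsets-0 m) (sumSubsets-0 m)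

sumSubsets-swap : ∀ m k (G : Vec Bool m → Vec Bool k → ℕ) →
  sumSubsets m (λ X → sumSubsets k (G X)) ≡ sumSubsets k (λ Y → sumSubsets m (λ X → G X Y))
sumSubsets-swap zero    k G = refl
sumSubsets-swap (suc m) k G = trans
  (cong₂ _+_ (sumSubsets-swap m k (λ X → G (false ∷ X))) (sumSubsets-swap m k (λ X → G (true ∷ X))))
  (sym (sumSubsets-+ k _ _))

if-sumSubsets : ∀ m (c : Bool) (G : Vec Bool m → ℕ) →
  (if c then sumSubsets m G else 0) ≡ sumSubsets m (λ X → if c then G X else 0)
if-sumSubsets m true  G = refl
if-sumSubsets m false G = sym (sumSubsets-0 m)

eqWord : ∀ {n} → Word n → Word n → Bool
eqWord u v = does (word-≟ u v)

eqWord-refl : ∀ {n} (u : Word n) → eqWord u u ≡ true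
eqWord-refl []          = refl
eqWord-refl (false ∷ u) = eqWord-refl u
eqWord-refl (true ∷ u)  = eqWord-refl u

eqWord⇒≡ : ∀ {n} (u v : Word n) → eqWord u v ≡ true → u ≡ v
eqWord⇒≡ []          []          _  = refl
eqWord⇒≡ (false ∷ u) (false ∷ v) eq = cong (false ∷_) (eqWord⇒≡ u v eq)
eqWord⇒≡ (true ∷ u)  (true ∷ v)  eq = cong (true ∷_) (eqWord⇒≡ u v eq)
eqWord⇒≡ (false ∷ u) (true ∷ v)  ()
eqWord⇒≡ (true ∷ u)  (false ∷ v) ()

eqWord-sym : ∀ {n} (u v : Word n) → eqWord u v ≡ eqWord v u
eqWord-sym []          []          = refl
eqWord-sym (false ∷ u) (false ∷ v) = eqWord-sym u v
eqWord-sym (true ∷ u)  (true ∷ v)  = eqWord-sym u v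
eqWord-sym (false ∷ u) (true ∷ v)  = refl
eqWord-sym (true ∷ u)  (false ∷ v) = refl

bit : Bool → ℕ
bit true  = 1
bit false = 0

count : ∀ {A : Set} → (A → Bool) → (L : List A) → Vec Bool (length L) → ℕ
count P []      []      = 0
count P (x ∷ L) (c ∷ X) = bit (P x ∧ c) + count P L X

countAll : ∀ {A : Set} (L : List A) → Vec Bool (length L) → ℕ
countAll = count (λ _ → true)

-- A vector X : Vec Bool (length W) is a subset of the word list W; entry W X u is its bit at u
-- (false when u does not occur in W).
entry : ∀ {n} (W : List (Word n)) → Vec Bool (length W) → Word n → Bool
entry []      []      u = false
entry (x ∷ W) (c ∷ X) u = if eqWord u x then c else entry W X u

occurs : ∀ {n} → Word n → List (Word n) → Bool
occurs u []      = false
occurs u (x ∷ W) = eqWord u x ∨ occurs u W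

Distinct : ∀ {n} → List (Word n) → Set
Distinct []      = ⊤
Distinct (x ∷ W) = (occurs x W ≡ false) × Distinct W

sumOver : ∀ {n} → List (Word n) → (Word n → ℕ) → ℕ
sumOver W f = sum (map f W)

allOver : ∀ {n} → List (Word n) → (Word n → Bool) → Bool
allOver W f = all f W

tabulateOn : ∀ {n} (W : List (Word n)) → (Word n → Bool) → Vec Bool (length W)
tabulateOn []      h = []
tabulateOn (x ∷ W) h = h x ∷ tabulateOn W h

sameBit : Bool → Bool → Bool
sameBit p q = not (p xor q)

∨≡false : ∀ {p q : Bool} → p ∨ q ≡ false → (p ≡ false) × (q ≡ false)
∨≡false {false} {false} _ = refl , refl

occurs-tail : ∀ {n} (w x : Word n) W → occurs w W ≡ true → occurs w (x ∷ W) ≡ true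
occurs-tail w x W w∈W = trans (cong (eqWord w x ∨_) w∈W) (∨-zeroʳ (eqWord w x))

occurs-head : ∀ {n} (x : Word n) W → occurs x (x ∷ W) ≡ true
occurs-head x W = cong (_∨ occurs x W) (eqWord-refl x)

eqWord-absent : ∀ {n} (w x : Word n) W → occurs w W ≡ true → occurs x W ≡ false → eqWord w x ≡ false
eqWord-absent w x W w∈W x∉W with eqWord w x in eq
... | false = refl
... | true rewrite eqWord⇒≡ w x eq with trans (sym w∈W) x∉W
...   | ()

count-absent : ∀ {n} (v : Word n) W X → occurs v W ≡ false → count (λ u → eqWord u v) W X ≡ 0
count-absent v []      []      _   = refl
count-absent v (x ∷ W) (c ∷ X) v∉ with ∨≡false {eqWord v x} v∉
... | v≢x , v∉W rewrite eqWord-sym x v | v≢x = count-absent v W X v∉W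

entry-absent : ∀ {n} (v : Word n) W X → occurs v W ≡ false → entry W X v ≡ false
entry-absent v []      []      _   = refl
entry-absent v (x ∷ W) (c ∷ X) v∉ with ∨≡false {eqWord v x} v∉
... | v≢x , v∉W rewrite v≢x = entry-absent v W X v∉W

count-eqWord : ∀ {n} (v : Word n) W X → Distinct W → count (λ u → eqWord u v) W X ≡ bit (entry W X v)
count-eqWord v []      []      _            = refl
count-eqWord v (x ∷ W) (c ∷ X) (x∉W , dW) with eqWord v x in eq
... | true  rewrite eqWord-sym x v | eq | eqWord⇒≡ v x eq | count-absent x W X x∉W = +-identityʳ (bit c)
... | false rewrite eqWord-sym x v | eq = count-eqWord v W X dW

count-cong : ∀ {A : Set} {P Q : A → Bool} L X → (∀ u → P u ≡ Q u) → count P L X ≡ count Q L X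
count-cong []      []      _   = refl
count-cong (x ∷ L) (c ∷ X) P≡Q = cong₂ _+_ (cong (λ z → bit (z ∧ c)) (P≡Q x)) (count-cong L X P≡Q)

count-none : ∀ {A : Set} (L : List A) X → count (λ _ → false) L X ≡ 0
count-none []      []      = refl
count-none (x ∷ L) (c ∷ X) = count-none L X

bit-∨ : ∀ p q c → p ∧ q ≡ false → bit ((p ∨ q) ∧ c) ≡ bit (p ∧ c) + bit (q ∧ c)
bit-∨ true  true  c     ()
bit-∨ true  false true  _ = refl
bit-∨ true  false false _ = refl
bit-∨ false q     c     _ = refl

count-∨ : ∀ {A : Set} (P Q : A → Bool) L X → (∀ u → P u ∧ Q u ≡ false) →
          count (λ u → P u ∨ Q u) L X ≡ count P L X + count Q L X
count-∨ P Q []      []      _        = refl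
count-∨ P Q (x ∷ L) (c ∷ X) disjoint =
  trans (cong₂ _+_ (bit-∨ (P x) (Q x) c (disjoint x)) (count-∨ P Q L X disjoint))
        (+-interchange (bit (P x ∧ c)) (bit (Q x ∧ c)) (count P L X) (count Q L X))

sumOver-cong : ∀ {n} (W : List (Word n)) {f g : Word n → ℕ} →
               (∀ w → occurs w W ≡ true → f w ≡ g w) → sumOver W f ≡ sumOver W g
sumOver-cong []      _   = refl
sumOver-cong (x ∷ W) f≡g =
  cong₂ _+_ (f≡g x (occurs-head x W)) (sumOver-cong W (λ w w∈W → f≡g w (occurs-tail w x W w∈W)))

allOver-cong : ∀ {n} (W : List (Word n)) {f g : Word n → Bool} →
               (∀ w → occurs w W ≡ true → f w ≡ g w) → allOver W f ≡ allOver W g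
allOver-cong []      _   = refl
allOver-cong (x ∷ W) f≡g =
  cong₂ _∧_ (f≡g x (occurs-head x W)) (allOver-cong W (λ w w∈W → f≡g w (occurs-tail w x W w∈W)))

countAll-sumOver : ∀ {n} (W : List (Word n)) X → Distinct W → countAll W X ≡ sumOver W (λ w → bit (entry W X w))
countAll-sumOver []      []      _            = refl
countAll-sumOver (x ∷ W) (c ∷ X) (x∉W , dW) rewrite eqWord-refl x =
  cong (bit c +_) (trans (countAll-sumOver W X dW) (sumOver-cong W (λ w w∈W →
    cong (λ z → bit (if z then c else entry W X w)) (sym (eqWord-absent w x W w∈W x∉W)))))

entry-tabulateOn : ∀ {n} (W : List (Word n)) h w → occurs w W ≡ true → entry W (tabulateOn W h) w ≡ h w
entry-tabulateOn []      h w ()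
entry-tabulateOn (x ∷ W) h w w∈ with eqWord w x in eq
... | true  = cong h (sym (eqWord⇒≡ w x eq))
... | false = entry-tabulateOn W h w w∈

countAll-tabulateOn : ∀ {n} (W : List (Word n)) h → countAll W (tabulateOn W h) ≡ sumOver W (λ w → bit (h w))
countAll-tabulateOn []      h = refl
countAll-tabulateOn (x ∷ W) h = cong (bit (h x) +_) (countAll-tabulateOn W h)

sumSubsets-pin : ∀ {n} (W : List (Word n)) (h : Word n → Bool) (G : Vec Bool (length W) → ℕ) → Distinct W →
  sumSubsets (length W) (λ X → if allOver W (λ w → sameBit (h w) (entry W X w)) then G X else 0)
  ≡ G (tabulateOn W h)
sumSubsets-pin []      h G _          = refl
sumSubsets-pin (x ∷ W) h G (x∉W , dW) =
  trans (cong₂ _+_ (sumSubsets-cong (length W) (split false)) (sumSubsets-cong (length W) (split true)))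
        (pinHead (h x))
  where
  agrees : Vec Bool (length W) → Bool
  agrees X = allOver W (λ w → sameBit (h w) (entry W X w))

  agrees-tail : ∀ c X → allOver W (λ w → sameBit (h w) (entry (x ∷ W) (c ∷ X) w)) ≡ agrees X
  agrees-tail c X = allOver-cong W (λ w w∈W →
    cong (λ z → sameBit (h w) (if z then c else entry W X w)) (eqWord-absent w x W w∈W x∉W))

  split : ∀ c X → (if allOver (x ∷ W) (λ w → sameBit (h w) (entry (x ∷ W) (c ∷ X) w)) then G (c ∷ X) else 0)
                ≡ (if sameBit (h x) c then (if agrees X then G (c ∷ X) else 0) else 0)
  split c X rewrite eqWord-refl x | agrees-tail c X with sameBit (h x) c
  ... | true  = refl
  ... | false = refl

  pinHead : ∀ hx →
      sumSubsets (length W) (λ X → if sameBit hx false then (if agrees X then G (false ∷ X) else 0) else 0)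
    + sumSubsets (length W) (λ X → if sameBit hx true then (if agrees X then G (true ∷ X) else 0) else 0)
    ≡ G (hx ∷ tabulateOn W h)
  pinHead true  = trans (cong (_+ sumSubsets (length W) (λ X → if agrees X then G (true ∷ X) else 0))
                                     (sumSubsets-0 (length W)))
                         (sumSubsets-pin W h (λ X → G (true ∷ X)) dW)
  pinHead false = trans (cong₂ _+_ (sumSubsets-pin W h (λ X → G (false ∷ X)) dW) (sumSubsets-0 (length W)))
                        (+-identityʳ _)

module _ {A : Set} where

  appendSel : (L₁ L₂ : List A) → Vec Bool (length L₁) → Vec Bool (length L₂) → Vec Bool (length (L₁ ++ L₂))
  appendSel []      L₂ []      Y = Y
  appendSel (x ∷ L₁) L₂ (c ∷ X) Y = c ∷ appendSel L₁ L₂ X Y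

  sumSubsets-++ : (L₁ L₂ : List A) (G : Vec Bool (length (L₁ ++ L₂)) → ℕ) →
    sumSubsets (length (L₁ ++ L₂)) G
    ≡ sumSubsets (length L₁) (λ X → sumSubsets (length L₂) (λ Y → G (appendSel L₁ L₂ X Y)))
  sumSubsets-++ []       L₂ G = refl
  sumSubsets-++ (x ∷ L₁) L₂ G =
    cong₂ _+_ (sumSubsets-++ L₁ L₂ (λ X → G (false ∷ X))) (sumSubsets-++ L₁ L₂ (λ X → G (true ∷ X)))

  count-++ : (P : A → Bool) (L₁ L₂ : List A) → ∀ X Y →
    count P (L₁ ++ L₂) (appendSel L₁ L₂ X Y) ≡ count P L₁ X + count P L₂ Y
  count-++ P []       L₂ []      Y = refl
  count-++ P (x ∷ L₁) L₂ (c ∷ X) Y =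
    trans (cong (bit (P x ∧ c) +_) (count-++ P L₁ L₂ X Y)) (sym (+-assoc (bit (P x ∧ c)) _ _))

  module _ {B : Set} (f : B → A) where

    alongMap : (L : List B) → Vec Bool (length L) → Vec Bool (length (map f L))
    alongMap []      []      = []
    alongMap (x ∷ L) (c ∷ X) = c ∷ alongMap L X

    sumSubsets-map : (L : List B) (G : Vec Bool (length (map f L)) → ℕ) →
      sumSubsets (length (map f L)) G ≡ sumSubsets (length L) (λ X → G (alongMap L X))
    sumSubsets-map []      G = refl
    sumSubsets-map (x ∷ L) G =
      cong₂ _+_ (sumSubsets-map L (λ X → G (false ∷ X))) (sumSubsets-map L (λ X → G (true ∷ X)))

    count-map : (P : A → Bool) (L : List B) → ∀ X → count P (map f L) (alongMap L X) ≡ count (λ u → P (f u)) L X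
    count-map P []      []      = refl
    count-map P (x ∷ L) (c ∷ X) = cong (bit (P (f x) ∧ c) +_) (count-map P L X)

size : ∀ {m} → Vec Bool m → ℕ
size []      = 0
size (c ∷ X) = bit c + size X

countAll-size : ∀ {A : Set} (L : List A) X → countAll L X ≡ size X
countAll-size []      []      = refl
countAll-size (x ∷ L) (c ∷ X) = cong (bit c +_) (countAll-size L X)

filterWords : ∀ {n} → (Word n → Bool) → List (Word n) → List (Word n)
filterWords d []      = []
filterWords d (x ∷ W) = if d x then x ∷ filterWords d W else filterWords d W

module _ {n : ℕ} (d : Word n → Bool) where

  interleave : (W : List (Word n)) → Vec Bool (length (filterWords d W)) →
               Vec Bool (length (filterWords (not ∘ d) W)) → Vec Bool (length W)
  interleave []      P       R       = []
  interleave (x ∷ W) P       R       with d x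
  interleave (x ∷ W) (p ∷ P) R       | true  = p ∷ interleave W P R
  interleave (x ∷ W) P       (r ∷ R) | false = r ∷ interleave W P R

  sumSubsets-interleave : (W : List (Word n)) (G : Vec Bool (length W) → ℕ) →
    sumSubsets (length W) G
    ≡ sumSubsets (length (filterWords d W)) (λ P →
        sumSubsets (length (filterWords (not ∘ d) W)) (λ R → G (interleave W P R)))
  sumSubsets-interleave []      G = refl
  sumSubsets-interleave (x ∷ W) G with d x
  ... | true  = cong₂ _+_ (sumSubsets-interleave W (λ X → G (false ∷ X)))
                          (sumSubsets-interleave W (λ X → G (true ∷ X)))
  ... | false = trans (cong₂ _+_ (sumSubsets-interleave W (λ X → G (false ∷ X)))
                                 (sumSubsets-interleave W (λ X → G (true ∷ X))))
                      (sym (sumSubsets-+ (length (filterWords d W)) _ _))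

  entry-interleave : (W : List (Word n)) → ∀ P R u →
    entry W (interleave W P R) u
    ≡ (if d u then entry (filterWords d W) P u else entry (filterWords (not ∘ d) W) R u)
  entry-interleave []      []      []      u with d u
  ... | true  = refl
  ... | false = refl
  entry-interleave (x ∷ W) P       R       u with d x in dx
  entry-interleave (x ∷ W) (p ∷ P) R       u | true  with eqWord u x in eq
  ... | true  rewrite eqWord⇒≡ u x eq | dx = refl
  ... | false = entry-interleave W P R u
  entry-interleave (x ∷ W) P       (r ∷ R) u | false with eqWord u x in eq
  ... | true  rewrite eqWord⇒≡ u x eq | dx = refl
  ... | false = entry-interleave W P R u

  countAll-interleave : (W : List (Word n)) → ∀ P R →
    countAll W (interleave W P R) ≡ countAll (filterWords d W) P + countAll (filterWords (not ∘ d) W) R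
  countAll-interleave []      []      []      = refl
  countAll-interleave (x ∷ W) P       R       with d x
  countAll-interleave (x ∷ W) (p ∷ P) R       | true  =
    trans (cong (bit p +_) (countAll-interleave W P R)) (sym (+-assoc (bit p) _ _))
  countAll-interleave (x ∷ W) P       (r ∷ R) | false =
    trans (cong (bit r +_) (countAll-interleave W P R)) (+-leftComm (bit r) (countAll (filterWords d W) P) _)

  absent-filterWords : (W : List (Word n)) → ∀ u → occurs u W ≡ false → occurs u (filterWords d W) ≡ false
  absent-filterWords []      u _  = refl
  absent-filterWords (x ∷ W) u u∉ with d x | ∨≡false {eqWord u x} u∉
  ... | true  | u≢x , u∉W rewrite u≢x = absent-filterWords W u u∉W
  ... | false | _   , u∉W = absent-filterWords W u u∉W

  rejected-filterWords : (W : List (Word n)) → ∀ u → d u ≡ false → occurs u (filterWords d W) ≡ false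
  rejected-filterWords []      u _   = refl
  rejected-filterWords (x ∷ W) u ¬du with d x in dx
  ... | false = rejected-filterWords W u ¬du
  ... | true  with eqWord u x in eq
  ...   | false = rejected-filterWords W u ¬du
  ...   | true rewrite eqWord⇒≡ u x eq with trans (sym ¬du) dx
  ...     | ()

  Distinct-filterWords : (W : List (Word n)) → Distinct W → Distinct (filterWords d W)
  Distinct-filterWords []      _          = tt
  Distinct-filterWords (x ∷ W) (x∉W , dW) with d x
  ... | true  = absent-filterWords W x x∉W , Distinct-filterWords W dW
  ... | false = Distinct-filterWords W dW

actInv : Gen → ∀ {n} → Word n → Word n
actInv s []          = []
actInv a (false ∷ w) = false ∷ actInv b w
actInv a (true ∷ w)  = true ∷ w
actInv b (false ∷ w) = true ∷ w
actInv b (true ∷ w)  = false ∷ actInv a w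

act-actInv : ∀ s {n} (w : Word n) → act s (actInv s w) ≡ w
act-actInv s []          = refl
act-actInv a (false ∷ w) = cong (false ∷_) (act-actInv b w)
act-actInv a (true ∷ w)  = refl
act-actInv b (false ∷ w) = refl
act-actInv b (true ∷ w)  = cong (true ∷_) (act-actInv a w)

actInv-act : ∀ s {n} (w : Word n) → actInv s (act s w) ≡ w
actInv-act s []          = refl
actInv-act a (false ∷ w) = cong (false ∷_) (actInv-act b w)
actInv-act a (true ∷ w)  = refl
actInv-act b (false ∷ w) = cong (false ∷_) (actInv-act a w)
actInv-act b (true ∷ w)  = refl

eqWord-act : ∀ s {n} (u v : Word n) → eqWord (act s u) v ≡ eqWord u (actInv s v)
eqWord-act s u v with eqWord (act s u) v in eq
... | true rewrite sym (eqWord⇒≡ (act s u) v eq) | actInv-act s u = sym (eqWord-refl u)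
... | false with eqWord u (actInv s v) in eq′
...   | false = refl
...   | true rewrite eqWord⇒≡ u (actInv s v) eq′ | act-actInv s v with trans (sym eq) (eqWord-refl v)
...     | ()

sumSubsets-actInv : ∀ s n (f : Word n → ℕ) → sumSubsets n (λ w → f (actInv s w)) ≡ sumSubsets n f
sumSubsets-actInv s zero    f = refl
sumSubsets-actInv a (suc n) f = cong (_+ sumSubsets n (λ w → f (true ∷ w)))
                                     (sumSubsets-actInv b n (λ w → f (false ∷ w)))
sumSubsets-actInv b (suc n) f = trans (cong (sumSubsets n (λ w → f (true ∷ w)) +_)
                                            (sumSubsets-actInv a n (λ w → f (false ∷ w))))
                                      (+-comm (sumSubsets n (λ w → f (true ∷ w))) _)

moves : Gen → ∀ {n} → Word n → Bool
moves s u = not (eqWord (act s u) u)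

moves-b : ∀ {n} (u : Word (suc n)) → moves b u ≡ true
moves-b (false ∷ u) = refl
moves-b (true ∷ u)  = refl

moves-a-true : ∀ {n} (u : Word n) → moves a (true ∷ u) ≡ false
moves-a-true u = cong not (eqWord-refl u)

actInv-fixed : ∀ s {n} (w : Word n) → moves s w ≡ false → actInv s w ≡ w
actInv-fixed s w fixed = trans (cong (actInv s) (sym (eqWord⇒≡ (act s w) w (not-injective fixed)))) (actInv-act s w)

moves-actInv : ∀ s {n} (w : Word n) → moves s w ≡ true → moves s (actInv s w) ≡ true
moves-actInv s w moved =
  trans (cong (λ z → not (eqWord z (actInv s w))) (act-actInv s w)) (trans (cong not (sym (eqWord-act s w w))) moved)

eqWord-actInv-disjoint : ∀ s {n} (w u : Word n) → moves s w ≡ true → eqWord u w ∧ eqWord u (actInv s w) ≡ false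
eqWord-actInv-disjoint s w u moved with eqWord u w in eq
... | false = refl
... | true rewrite eqWord⇒≡ u w eq = trans (sym (eqWord-act s w w)) (not-injective moved)

occurs-map-∷ : ∀ {n} c (u : Word n) W → occurs (c ∷ u) (map (c ∷_) W) ≡ occurs u W
occurs-map-∷ false u []      = refl
occurs-map-∷ true  u []      = refl
occurs-map-∷ false u (x ∷ W) = cong (eqWord u x ∨_) (occurs-map-∷ false u W)
occurs-map-∷ true  u (x ∷ W) = cong (eqWord u x ∨_) (occurs-map-∷ true u W)

occurs-map-∷-not : ∀ {n} c (u : Word n) W → occurs (c ∷ u) (map (not c ∷_) W) ≡ false
occurs-map-∷-not c     u []      = refl
occurs-map-∷-not false u (x ∷ W) = occurs-map-∷-not false u W
occurs-map-∷-not true  u (x ∷ W) = occurs-map-∷-not true u W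

occurs-++ : ∀ {n} (u : Word n) V W → occurs u (V ++ W) ≡ occurs u V ∨ occurs u W
occurs-++ u []      W = refl
occurs-++ u (x ∷ V) W rewrite occurs-++ u V W = sym (∨-assoc (eqWord u x) (occurs u V) (occurs u W))

Distinct-map-∷ : ∀ {n} c (W : List (Word n)) → Distinct W → Distinct (map (c ∷_) W)
Distinct-map-∷ c []      _          = tt
Distinct-map-∷ c (x ∷ W) (x∉W , dW) = trans (occurs-map-∷ c x W) x∉W , Distinct-map-∷ c W dW

Distinct-++ : ∀ {n} (V W : List (Word n)) → Distinct V → Distinct W →
              (∀ u → occurs u V ≡ true → occurs u W ≡ false) → Distinct (V ++ W)
Distinct-++ []      W _          dW _        = dW
Distinct-++ (x ∷ V) W (x∉V , dV) dW disjoint =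
  trans (occurs-++ x V W) (cong₂ _∨_ x∉V (disjoint x (occurs-head x V))) ,
  Distinct-++ V W dV dW (λ u u∈V → disjoint u (occurs-tail u x V u∈V))

allWords-distinct : ∀ n → Distinct (allWords n)
allWords-distinct zero    = refl , tt
allWords-distinct (suc n) =
  Distinct-++ (map (false ∷_) W) (map (true ∷_) W)
              (Distinct-map-∷ false W (allWords-distinct n)) (Distinct-map-∷ true W (allWords-distinct n))
              disjoint
  where
  W = allWords n
  disjoint : ∀ u → occurs u (map (false ∷_) W) ≡ true → occurs u (map (true ∷_) W) ≡ false
  disjoint (false ∷ u) _ = occurs-map-∷-not false u W
  disjoint (true ∷ u) u∈ rewrite occurs-map-∷-not true u W with u∈
  ... | ()

filter-map : ∀ {n} {A : Set} {P : A → Set} (P? : Decidable P) (f : Word n → A) (W : List (Word n)) →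
  filter P? (map f W) ≡ map f (filterWords (λ u → does (P? (f u))) W)
filter-map P? f []      = refl
filter-map P? f (x ∷ W) with does (P? (f x))
... | true  = cong (f x ∷_) (filter-map P? f W)
... | false = filter-map P? f W

filterWords-all : ∀ {n} (d : Word n → Bool) W → (∀ u → d u ≡ true) → filterWords d W ≡ W
filterWords-all d []      _   = refl
filterWords-all d (x ∷ W) all rewrite all x = cong (x ∷_) (filterWords-all d W all)

filterWords-none : ∀ {n} (d : Word n → Bool) W → (∀ u → d u ≡ false) → filterWords d W ≡ []
filterWords-none d []      _    = refl
filterWords-none d (x ∷ W) none rewrite none x = filterWords-none d W none

filterWords-++ : ∀ {n} (d : Word n → Bool) V W → filterWords d (V ++ W) ≡ filterWords d V ++ filterWords d W
filterWords-++ d []      W = refl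
filterWords-++ d (x ∷ V) W with d x
... | true  = cong (x ∷_) (filterWords-++ d V W)
... | false = filterWords-++ d V W

filterWords-map-∷ : ∀ {n} (d : Word (suc n) → Bool) c (W : List (Word n)) →
  filterWords d (map (c ∷_) W) ≡ map (c ∷_) (filterWords (λ u → d (c ∷ u)) W)
filterWords-map-∷ d c []      = refl
filterWords-map-∷ d c (x ∷ W) with d (c ∷ x)
... | true  = cong ((c ∷ x) ∷_) (filterWords-map-∷ d c W)
... | false = filterWords-map-∷ d c W

filterWords-allWords-suc : ∀ {n} (d : Word (suc n) → Bool) →
  filterWords d (allWords (suc n))
  ≡ map (false ∷_) (filterWords (λ u → d (false ∷ u)) (allWords n))
    ++ map (true ∷_) (filterWords (λ u → d (true ∷ u)) (allWords n))
filterWords-allWords-suc {n} d =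
  trans (filterWords-++ d (map (false ∷_) (allWords n)) _)
        (cong₂ _++_ (filterWords-map-∷ d false (allWords n)) (filterWords-map-∷ d true (allWords n)))

edge : Gen → ∀ {n} → Word n → Edge n
edge s u = s , u

edgeAt : Gen → Bool → ∀ {n} → Word n → Edge (suc n)
edgeAt s c u = edge s (c ∷ u)

edges-suc : ∀ m →
  edges (suc m) ≡ map (edge a) (filterWords (moves a) (allWords (suc m))) ++ map (edge b) (allWords (suc m))
edges-suc m =
  trans (filter-++ P? (map (edge a) W) (map (edge b) W ++ []))
        (cong₂ _++_ (filter-map P? (edge a) W)
                    (trans (cong (filter P?) (++-identityʳ (map (edge b) W)))
                           (trans (filter-map P? (edge b) W) (cong (map (edge b)) (filterWords-all _ W moves-b)))))
  where
  W = allWords (suc m)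
  P? = λ (e : Edge (suc m)) → ¬? (word-≟ (act (proj₁ e) (proj₂ e)) (proj₂ e))

-- The letter a moves exactly the words 0u, and b moves every word.
edges-suc-suc : ∀ m → let W = allWords (suc m) in
  edges (suc (suc m)) ≡ map (edgeAt a false) W ++ (map (edgeAt b false) W ++ map (edgeAt b true) W)
edges-suc-suc m = trans (edges-suc (suc m)) (cong₂ _++_ aEdges bEdges)
  where
  open ≡-Reasoning
  W = allWords (suc m)
  aEdges : map (edge a) (filterWords (moves a) (allWords (suc (suc m)))) ≡ map (edgeAt a false) W
  aEdges = begin
      map (edge a) (filterWords (moves a) (allWords (suc (suc m))))
    ≡⟨ cong (map (edge a)) (filterWords-allWords-suc (moves a)) ⟩
      map (edge a) (map (false ∷_) (filterWords (λ u → moves a (false ∷ u)) W)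
                  ++ map (true ∷_) (filterWords (λ u → moves a (true ∷ u)) W))
    ≡⟨ cong₂ (λ p q → map (edge a) (map (false ∷_) p ++ map (true ∷_) q))
             (filterWords-all _ W moves-b) (filterWords-none _ W moves-a-true) ⟩
      map (edge a) (map (false ∷_) W ++ [])
    ≡⟨ cong (map (edge a)) (++-identityʳ _) ⟩
      map (edge a) (map (false ∷_) W)
    ≡⟨ map-∘ W ⟨
      map (edgeAt a false) W ∎
  bEdges : map (edge b) (allWords (suc (suc m))) ≡ map (edgeAt b false) W ++ map (edgeAt b true) W
  bEdges = trans (map-++ (edge b) (map (false ∷_) W) (map (true ∷_) W))
                 (cong₂ _++_ (sym (map-∘ W)) (sym (map-∘ W)))

module _ {n : ℕ} where

  selectFrom : (L : List (Edge n)) → Vec Bool (length L) → List (Edge n)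
  selectFrom L X = map proj₁ (filter (λ p → proj₂ p ≟ᵇ true) (zip L (toList X)))

  length-filter-selectFrom : {Q : Edge n → Set} (Q? : Decidable Q) (L : List (Edge n)) → ∀ X →
    length (filter Q? (selectFrom L X)) ≡ count (λ e → does (Q? e)) L X
  length-filter-selectFrom Q? []      []          = refl
  length-filter-selectFrom Q? (e ∷ L) (false ∷ X) with does (Q? e)
  ... | true  = length-filter-selectFrom Q? L X
  ... | false = length-filter-selectFrom Q? L X
  length-filter-selectFrom Q? (e ∷ L) (true ∷ X)  with does (Q? e)
  ... | true  = cong suc (length-filter-selectFrom Q? L X)
  ... | false = length-filter-selectFrom Q? L X

  degreeIn : Word n → (L : List (Edge n)) → Vec Bool (length L) → ℕ
  degreeIn v L X = length (filter (incident? v) (selectFrom L X))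

  isClosedIn : (L : List (Edge n)) → Vec Bool (length L) → Bool
  isClosedIn L X = does (all? (λ v → degreeIn v L X % 2 ≟ 0) (allWords n))

  labelCountIn : Gen → (L : List (Edge n)) → Vec Bool (length L) → ℕ
  labelCountIn w L X = length (filter (λ e → gen-≟ (label e) w) (selectFrom L X))

  polygonSum : (L : List (Edge n)) → (ℕ → ℕ → ℕ) → ℕ
  polygonSum L F =
    sumSubsets (length L) (λ X → if isClosedIn L X then F (labelCountIn a L X) (labelCountIn b L X) else 0)

does-all? : ∀ {n} {Q : Word n → Set} (Q? : Decidable Q) (W : List (Word n)) →
            does (all? Q? W) ≡ allOver W (λ v → does (Q? v))
does-all? Q? []      = refl
does-all? Q? (x ∷ W) = cong (does (Q? x) ∧_) (does-all? Q? W)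

allOver-++ : ∀ {n} (V W : List (Word n)) f → allOver (V ++ W) f ≡ allOver V f ∧ allOver W f
allOver-++ []      W f = refl
allOver-++ (x ∷ V) W f = trans (cong (f x ∧_) (allOver-++ V W f)) (sym (∧-assoc (f x) _ _))

allOver-map : ∀ {n k} (g : Word n → Word k) (W : List (Word n)) f → allOver (map g W) f ≡ allOver W (λ w → f (g w))
allOver-map g []      f = refl
allOver-map g (x ∷ W) f = cong (f (g x) ∧_) (allOver-map g W f)

evenSum4 : Bool → Bool → Bool → Bool → Bool
evenSum4 p q r s = not ((p xor q) xor (r xor s))

even-bits4 : ∀ p q r s → does (((bit p + bit q) + (bit r + bit s)) % 2 ≟ 0) ≡ evenSum4 p q r s
even-bits4 false false false false = refl
even-bits4 false false false true  = refl
even-bits4 false false true  false = refl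
even-bits4 false false true  true  = refl
even-bits4 false true  false false = refl
even-bits4 false true  false true  = refl
even-bits4 false true  true  false = refl
even-bits4 false true  true  true  = refl
even-bits4 true  false false false = refl
even-bits4 true  false false true  = refl
even-bits4 true  false true  false = refl
even-bits4 true  false true  true  = refl
even-bits4 true  true  false false = refl
even-bits4 true  true  false true  = refl
even-bits4 true  true  true  false = refl
even-bits4 true  true  true  true  = refl

even-bits2 : ∀ p q → does ((0 + (bit p + bit q)) % 2 ≟ 0) ≡ sameBit p q
even-bits2 false false = refl
even-bits2 false true  = refl
even-bits2 true  false = refl
even-bits2 true  true  = refl

count-incident : ∀ s {n} (V : List (Word n)) X v → Distinct V → (moves s v ≡ false → occurs v V ≡ false) →
  count (λ u → eqWord u v ∨ eqWord (act s u) v) V X ≡ bit (entry V X v) + bit (entry V X (actInv s v))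
count-incident s V X v dV fixed⇒absent =
  trans (count-cong V X (λ u → cong (eqWord u v ∨_) (eqWord-act s u v))) (byMoves (moves s v) refl)
  where
  byMoves : ∀ t → moves s v ≡ t →
    count (λ u → eqWord u v ∨ eqWord u (actInv s v)) V X ≡ bit (entry V X v) + bit (entry V X (actInv s v))
  byMoves true  moved =
    trans (count-∨ (λ u → eqWord u v) (λ u → eqWord u (actInv s v)) V X (λ u → eqWord-actInv-disjoint s v u moved))
          (cong₂ _+_ (count-eqWord v V X dV) (count-eqWord (actInv s v) V X dV))
  byMoves false fixed rewrite actInv-fixed s v fixed | entry-absent v V X (fixed⇒absent fixed) =
    trans (count-cong V X (λ u → ∨-idem (eqWord u v)))
          (trans (count-eqWord v V X dV) (cong bit (entry-absent v V X (fixed⇒absent fixed))))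

b-fixes-nothing : ∀ {n} (v : Word (suc n)) V → moves b v ≡ false → occurs v V ≡ false
b-fixes-nothing v V fixed with trans (sym (moves-b v)) fixed
... | ()

-- Σ_{m+1}: P selects the a-edges (at the words moved by a), Q the b-edges.
module OneLevel (m : ℕ) where

  W : List (Word (suc m))
  W = allWords (suc m)

  M : List (Word (suc m))
  M = filterWords (moves a) W

  aEdges bEdges : List (Edge (suc m))
  aEdges = map (edge a) M
  bEdges = map (edge b) W

  dW : Distinct W
  dW = allWords-distinct (suc m)

  dM : Distinct M
  dM = Distinct-filterWords (moves a) W dW

  closedᵇ : Vec Bool (length M) → Vec Bool (length W) → Bool
  closedᵇ P Q = allOver W (λ v →
    evenSum4 (entry M P v) (entry M P (actInv a v)) (entry W Q v) (entry W Q (actInv b v)))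

  levelSum : (ℕ → ℕ → ℕ) → ℕ
  levelSum F = sumSubsets (length M) (λ P → sumSubsets (length W) (λ Q →
    if closedᵇ P Q then F (countAll M P) (countAll W Q) else 0))

  selection : Vec Bool (length M) → Vec Bool (length W) → Vec Bool (length (aEdges ++ bEdges))
  selection P Q = appendSel aEdges bEdges (alongMap (edge a) M P) (alongMap (edge b) W Q)

  count-selection : ∀ (E : Edge (suc m) → Bool) P Q →
    count E (aEdges ++ bEdges) (selection P Q) ≡ count (λ u → E (a , u)) M P + count (λ u → E (b , u)) W Q
  count-selection E P Q =
    trans (count-++ E aEdges bEdges (alongMap (edge a) M P) (alongMap (edge b) W Q))
          (cong₂ _+_ (count-map (edge a) E M P) (count-map (edge b) E W Q))

  degree-selection : ∀ P Q v → degreeIn v (aEdges ++ bEdges) (selection P Q)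
    ≡ (bit (entry M P v) + bit (entry M P (actInv a v))) + (bit (entry W Q v) + bit (entry W Q (actInv b v)))
  degree-selection P Q v =
    trans (length-filter-selectFrom (incident? v) (aEdges ++ bEdges) (selection P Q))
          (trans (count-selection _ P Q)
                 (cong₂ _+_ (count-incident a M P v dM (rejected-filterWords (moves a) W v))
                            (count-incident b W Q v dW (b-fixes-nothing v W))))

  isClosed-selection : ∀ P Q → isClosedIn (aEdges ++ bEdges) (selection P Q) ≡ closedᵇ P Q
  isClosed-selection P Q = trans (does-all? _ W) (allOver-cong W (λ v _ →
    trans (cong (λ d → does (d % 2 ≟ 0)) (degree-selection P Q v))
          (even-bits4 (entry M P v) (entry M P (actInv a v)) (entry W Q v) (entry W Q (actInv b v)))))

  aCount-selection : ∀ P Q → labelCountIn a (aEdges ++ bEdges) (selection P Q) ≡ countAll M P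
  aCount-selection P Q =
    trans (length-filter-selectFrom _ (aEdges ++ bEdges) (selection P Q))
          (trans (trans (count-selection _ P Q) (cong (countAll M P +_) (count-none W Q))) (+-identityʳ _))

  bCount-selection : ∀ P Q → labelCountIn b (aEdges ++ bEdges) (selection P Q) ≡ countAll W Q
  bCount-selection P Q =
    trans (length-filter-selectFrom _ (aEdges ++ bEdges) (selection P Q))
          (trans (count-selection _ P Q) (cong (_+ countAll W Q) (count-none M P)))

  polygonSum-levelSum : ∀ F → polygonSum (edges (suc m)) F ≡ levelSum F
  polygonSum-levelSum F = begin
      polygonSum (edges (suc m)) F
    ≡⟨ cong (λ L → polygonSum L F) (edges-suc m) ⟩
      sumSubsets (length (aEdges ++ bEdges)) body
    ≡⟨ sumSubsets-++ aEdges bEdges body ⟩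
      sumSubsets (length aEdges) (λ Y → sumSubsets (length bEdges) (λ Z → body (appendSel aEdges bEdges Y Z)))
    ≡⟨ sumSubsets-map (edge a) M _ ⟩
      sumSubsets (length M) (λ P → sumSubsets (length bEdges) (λ Z →
        body (appendSel aEdges bEdges (alongMap (edge a) M P) Z)))
    ≡⟨ sumSubsets-cong (length M) (λ P → sumSubsets-map (edge b) W _) ⟩
      sumSubsets (length M) (λ P → sumSubsets (length W) (λ Q → body (selection P Q)))
    ≡⟨ sumSubsets-cong (length M) (λ P → sumSubsets-cong (length W) (λ Q →
         cong₂ (λ c z → if c then z else 0) (isClosed-selection P Q)
                                            (cong₂ F (aCount-selection P Q) (bCount-selection P Q)))) ⟩
      levelSum F ∎
    where
    open ≡-Reasoning
    body : Vec Bool (length (aEdges ++ bEdges)) → ℕ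
    body X = if isClosedIn (aEdges ++ bEdges) X
             then F (labelCountIn a (aEdges ++ bEdges) X) (labelCountIn b (aEdges ++ bEdges) X) else 0

-- Σ_{m+2}: X₁ selects the a-edges at the words 0u, X₂ and X₃ the b-edges at 0u and at 1u.
module TwoLevels (m : ℕ) where

  W : List (Word (suc m))
  W = allWords (suc m)

  a₀Edges b₀Edges b₁Edges allEdges : List (Edge (suc (suc m)))
  a₀Edges  = map (edgeAt a false) W
  b₀Edges  = map (edgeAt b false) W
  b₁Edges  = map (edgeAt b true) W
  allEdges = a₀Edges ++ (b₀Edges ++ b₁Edges)

  dW : Distinct W
  dW = allWords-distinct (suc m)

  Sel : Set
  Sel = Vec Bool (length W)

  selection : Sel → Sel → Sel → Vec Bool (length allEdges)
  selection X₁ X₂ X₃ = appendSel a₀Edges (b₀Edges ++ b₁Edges) (alongMap (edgeAt a false) W X₁)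
                         (appendSel b₀Edges b₁Edges (alongMap (edgeAt b false) W X₂) (alongMap (edgeAt b true) W X₃))

  count-selection : ∀ (E : Edge (suc (suc m)) → Bool) X₁ X₂ X₃ → count E allEdges (selection X₁ X₂ X₃)
    ≡ count (λ u → E (edgeAt a false u)) W X₁
      + (count (λ u → E (edgeAt b false u)) W X₂ + count (λ u → E (edgeAt b true u)) W X₃)
  count-selection E X₁ X₂ X₃ =
    trans (count-++ E a₀Edges (b₀Edges ++ b₁Edges) _ _)
          (cong₂ _+_ (count-map (edgeAt a false) E W X₁)
                     (trans (count-++ E b₀Edges b₁Edges _ _)
                            (cong₂ _+_ (count-map (edgeAt b false) E W X₂) (count-map (edgeAt b true) E W X₃))))

  degree-selection : ∀ v X₁ X₂ X₃ → degreeIn v allEdges (selection X₁ X₂ X₃)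
    ≡ count (λ u → does (incident? v (edgeAt a false u))) W X₁
      + (count (λ u → does (incident? v (edgeAt b false u))) W X₂
         + count (λ u → does (incident? v (edgeAt b true u))) W X₃)
  degree-selection v X₁ X₂ X₃ =
    trans (length-filter-selectFrom (incident? v) allEdges (selection X₁ X₂ X₃)) (count-selection _ X₁ X₂ X₃)

  degree-selection₀ : ∀ w X₁ X₂ X₃ → degreeIn (false ∷ w) allEdges (selection X₁ X₂ X₃)
    ≡ (bit (entry W X₁ w) + bit (entry W X₁ (actInv b w))) + (bit (entry W X₂ w) + bit (entry W X₃ w))
  degree-selection₀ w X₁ X₂ X₃ = trans (degree-selection (false ∷ w) X₁ X₂ X₃)
    (cong₂ _+_ (count-incident b W X₁ w dW (b-fixes-nothing w W))
               (cong₂ _+_ (trans (count-cong W X₂ (λ u → ∨-identityʳ (eqWord u w))) (count-eqWord w W X₂ dW))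
                          (count-eqWord w W X₃ dW)))

  degree-selection₁ : ∀ w X₁ X₂ X₃ → degreeIn (true ∷ w) allEdges (selection X₁ X₂ X₃)
    ≡ 0 + (bit (entry W X₂ (actInv a w)) + bit (entry W X₃ w))
  degree-selection₁ w X₁ X₂ X₃ = trans (degree-selection (true ∷ w) X₁ X₂ X₃)
    (cong₂ _+_ (count-none W X₁)
               (cong₂ _+_ (trans (count-cong W X₂ (λ u → eqWord-act a u w)) (count-eqWord (actInv a w) W X₂ dW))
                          (trans (count-cong W X₃ (λ u → ∨-identityʳ (eqWord u w))) (count-eqWord w W X₃ dW))))

  evenAt0ᵇ : Sel → Sel → Sel → Bool
  evenAt0ᵇ X₁ X₂ X₃ = allOver W (λ w →
    evenSum4 (entry W X₁ w) (entry W X₁ (actInv b w)) (entry W X₂ w) (entry W X₃ w))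

  evenAt1ᵇ : Sel → Sel → Bool
  evenAt1ᵇ X₂ X₃ = allOver W (λ w → sameBit (entry W X₂ (actInv a w)) (entry W X₃ w))

  isClosed-selection : ∀ X₁ X₂ X₃ →
    isClosedIn allEdges (selection X₁ X₂ X₃) ≡ evenAt0ᵇ X₁ X₂ X₃ ∧ evenAt1ᵇ X₂ X₃
  isClosed-selection X₁ X₂ X₃ =
    trans (does-all? _ (allWords (suc (suc m))))
          (trans (allOver-++ (map (false ∷_) W) (map (true ∷_) W) _)
                 (cong₂ _∧_ (trans (allOver-map (false ∷_) W _) (allOver-cong W (λ w _ → evenAt0 w)))
                            (trans (allOver-map (true ∷_) W _) (allOver-cong W (λ w _ → evenAt1 w)))))
    where
    evenAt0 : ∀ w → does (degreeIn (false ∷ w) allEdges (selection X₁ X₂ X₃) % 2 ≟ 0)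
                  ≡ evenSum4 (entry W X₁ w) (entry W X₁ (actInv b w)) (entry W X₂ w) (entry W X₃ w)
    evenAt0 w = trans (cong (λ d → does (d % 2 ≟ 0)) (degree-selection₀ w X₁ X₂ X₃))
                      (even-bits4 (entry W X₁ w) (entry W X₁ (actInv b w)) (entry W X₂ w) (entry W X₃ w))
    evenAt1 : ∀ w → does (degreeIn (true ∷ w) allEdges (selection X₁ X₂ X₃) % 2 ≟ 0)
                  ≡ sameBit (entry W X₂ (actInv a w)) (entry W X₃ w)
    evenAt1 w = trans (cong (λ d → does (d % 2 ≟ 0)) (degree-selection₁ w X₁ X₂ X₃))
                      (even-bits2 (entry W X₂ (actInv a w)) (entry W X₃ w))

  aCount-selection : ∀ X₁ X₂ X₃ → labelCountIn a allEdges (selection X₁ X₂ X₃) ≡ countAll W X₁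
  aCount-selection X₁ X₂ X₃ =
    trans (length-filter-selectFrom _ allEdges (selection X₁ X₂ X₃))
          (trans (count-selection _ X₁ X₂ X₃)
                 (trans (cong (countAll W X₁ +_) (cong₂ _+_ (count-none W X₂) (count-none W X₃))) (+-identityʳ _)))

  bCount-selection : ∀ X₁ X₂ X₃ →
    labelCountIn b allEdges (selection X₁ X₂ X₃) ≡ countAll W X₂ + countAll W X₃
  bCount-selection X₁ X₂ X₃ =
    trans (length-filter-selectFrom _ allEdges (selection X₁ X₂ X₃))
          (trans (count-selection _ X₁ X₂ X₃) (cong (_+ (countAll W X₂ + countAll W X₃)) (count-none W X₁)))

  twoLevelSum : (ℕ → ℕ → ℕ) → ℕ
  twoLevelSum F = sumSubsets (length W) (λ X₁ → sumSubsets (length W) (λ X₂ → sumSubsets (length W) (λ X₃ →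
    if evenAt0ᵇ X₁ X₂ X₃ ∧ evenAt1ᵇ X₂ X₃ then F (countAll W X₁) (countAll W X₂ + countAll W X₃) else 0)))

  polygonSum-twoLevelSum : ∀ F → polygonSum (edges (suc (suc m))) F ≡ twoLevelSum F
  polygonSum-twoLevelSum F = begin
      polygonSum (edges (suc (suc m))) F
    ≡⟨ cong (λ L → polygonSum L F) (edges-suc-suc m) ⟩
      sumSubsets (length allEdges) body
    ≡⟨ sumSubsets-++ a₀Edges (b₀Edges ++ b₁Edges) body ⟩
      sumSubsets (length a₀Edges) (λ Y → sumSubsets (length (b₀Edges ++ b₁Edges)) (λ Z →
        body (appendSel a₀Edges (b₀Edges ++ b₁Edges) Y Z)))
    ≡⟨ sumSubsets-map (edgeAt a false) W _ ⟩
      sumSubsets (length W) (λ X₁ → sumSubsets (length (b₀Edges ++ b₁Edges)) (λ Z →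
        body (appendSel a₀Edges (b₀Edges ++ b₁Edges) (alongMap (edgeAt a false) W X₁) Z)))
    ≡⟨ sumSubsets-cong (length W) (λ X₁ → trans (sumSubsets-++ b₀Edges b₁Edges _)
         (trans (sumSubsets-map (edgeAt b false) W _)
                (sumSubsets-cong (length W) (λ X₂ → sumSubsets-map (edgeAt b true) W _)))) ⟩
      sumSubsets (length W) (λ X₁ → sumSubsets (length W) (λ X₂ → sumSubsets (length W) (λ X₃ →
        body (selection X₁ X₂ X₃))))
    ≡⟨ sumSubsets-cong (length W) (λ X₁ → sumSubsets-cong (length W) (λ X₂ → sumSubsets-cong (length W) (λ X₃ →
         cong₂ (λ c z → if c then z else 0) (isClosed-selection X₁ X₂ X₃)
               (cong₂ F (aCount-selection X₁ X₂ X₃) (bCount-selection X₁ X₂ X₃))))) ⟩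
      twoLevelSum F ∎
    where
    open ≡-Reasoning
    body : Vec Bool (length allEdges) → ℕ
    body X = if isClosedIn allEdges X then F (labelCountIn a allEdges X) (labelCountIn b allEdges X) else 0

if-∧ : ∀ x y (g : ℕ) → (if x ∧ y then g else 0) ≡ (if y then (if x then g else 0) else 0)
if-∧ true  true  g = refl
if-∧ true  false g = refl
if-∧ false true  g = refl
if-∧ false false g = refl

evenSum4-swap : ∀ x y p q → evenSum4 x y p q ≡ evenSum4 p q x y
evenSum4-swap x y p q = cong not (xor-comm (x xor y) (p xor q))

evenSum4-double : ∀ x y r → evenSum4 x y r r ≡ evenSum4 false false x y
evenSum4-double x y r = cong not (trans (cong ((x xor y) xor_) (xor-same r)) (xor-identityʳ (x xor y)))

aFixed : (m : ℕ) → List (Word (suc m))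
aFixed m = filterWords (not ∘ moves a) (allWords (suc m))

foldWeight : (m : ℕ) → (ℕ → ℕ → ℕ) → ℕ → ℕ → ℕ
foldWeight m F p q = sumSubsets (length (aFixed m)) (λ R → F q ((p + size R) + (p + size R)))

module Reduction (m : ℕ) where
  open TwoLevels m
  open OneLevel m using (M; dM; closedᵇ; levelSum)

  pinnedᵇ : Sel → Sel → Bool
  pinnedᵇ X₁ X₂ = allOver W (λ w →
    evenSum4 (entry W X₁ w) (entry W X₁ (actInv b w)) (entry W X₂ w) (entry W X₂ (actInv a w)))

  pinnedTerm : (ℕ → ℕ → ℕ) → Sel → Sel → ℕ
  pinnedTerm F X₁ X₂ = if pinnedᵇ X₁ X₂ then F (countAll W X₁) (countAll W X₂ + countAll W X₂) else 0

  -- The even degrees at the vertices 1w force X₃ = X₂ ∘ a⁻¹.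
  sum-X₃ : ∀ F X₁ X₂ → sumSubsets (length W) (λ X₃ →
             if evenAt0ᵇ X₁ X₂ X₃ ∧ evenAt1ᵇ X₂ X₃ then F (countAll W X₁) (countAll W X₂ + countAll W X₃) else 0)
           ≡ pinnedTerm F X₁ X₂
  sum-X₃ F X₁ X₂ =
    trans (sumSubsets-cong (length W) (λ X₃ → if-∧ (evenAt0ᵇ X₁ X₂ X₃) (evenAt1ᵇ X₂ X₃) _))
          (trans (sumSubsets-pin W h (λ X₃ → if evenAt0ᵇ X₁ X₂ X₃
                                             then F (countAll W X₁) (countAll W X₂ + countAll W X₃) else 0) dW)
                 (cong₂ (λ c z → if c then F (countAll W X₁) (countAll W X₂ + z) else 0)
                        (allOver-cong W (λ w w∈W → cong (evenSum4 (entry W X₁ w) (entry W X₁ (actInv b w)) (entry W X₂ w))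
                                                        (entry-tabulateOn W h w w∈W)))
                        countAll-h))
    where
    h : Word (suc m) → Bool
    h w = entry W X₂ (actInv a w)
    countAll-h : countAll W (tabulateOn W h) ≡ countAll W X₂
    countAll-h = begin
        countAll W (tabulateOn W h)                       ≡⟨ countAll-tabulateOn W h ⟩
        sumOver W (λ w → bit (h w))                       ≡⟨ sum-allWords (suc m) _ ⟩
        sumSubsets (suc m) (λ w → bit (h w))              ≡⟨ sumSubsets-actInv a (suc m) (λ w → bit (entry W X₂ w)) ⟩
        sumSubsets (suc m) (λ w → bit (entry W X₂ w))     ≡⟨ sum-allWords (suc m) _ ⟨
        sumOver W (λ w → bit (entry W X₂ w))              ≡⟨ countAll-sumOver W X₂ dW ⟨
        countAll W X₂                                     ∎
      where open ≡-Reasoning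

  pinnedᵇ-interleave : ∀ X₁ P R → pinnedᵇ X₁ (interleave (moves a) W P R) ≡ closedᵇ P X₁
  pinnedᵇ-interleave X₁ P R = allOver-cong W (λ w _ → byMoves w (moves a w) refl)
    where
    X₂ = interleave (moves a) W P R
    entry-X₂ : ∀ u t → moves a u ≡ t → entry W X₂ u ≡ (if t then entry M P u else entry (aFixed m) R u)
    entry-X₂ u t eq = trans (entry-interleave (moves a) W P R u)
                            (cong (λ c → if c then entry M P u else entry (aFixed m) R u) eq)
    byMoves : ∀ w t → moves a w ≡ t →
      evenSum4 (entry W X₁ w) (entry W X₁ (actInv b w)) (entry W X₂ w) (entry W X₂ (actInv a w))
      ≡ evenSum4 (entry M P w) (entry M P (actInv a w)) (entry W X₁ w) (entry W X₁ (actInv b w))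
    byMoves w true moved =
      trans (cong₂ (evenSum4 (entry W X₁ w) (entry W X₁ (actInv b w)))
                   (entry-X₂ w true moved) (entry-X₂ (actInv a w) true (moves-actInv a w moved)))
            (evenSum4-swap (entry W X₁ w) (entry W X₁ (actInv b w)) (entry M P w) (entry M P (actInv a w)))
    byMoves w false fixed =
      trans (cong₂ (evenSum4 (entry W X₁ w) (entry W X₁ (actInv b w)))
                   (entry-X₂ w false fixed) (trans (cong (entry W X₂) a⁻¹w≡w) (entry-X₂ w false fixed)))
            (trans (evenSum4-double (entry W X₁ w) (entry W X₁ (actInv b w)) (entry (aFixed m) R w))
                   (cong₂ (λ p q → evenSum4 p q (entry W X₁ w) (entry W X₁ (actInv b w)))
                          (sym P-absent) (sym (trans (cong (entry M P) a⁻¹w≡w) P-absent))))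
      where
      a⁻¹w≡w = actInv-fixed a w fixed
      P-absent = entry-absent w M P (rejected-filterWords (moves a) W w fixed)

  countAll-interleave-aFixed : ∀ P R → countAll W (interleave (moves a) W P R) ≡ countAll M P + size R
  countAll-interleave-aFixed P R =
    trans (countAll-interleave (moves a) W P R) (cong (countAll M P +_) (countAll-size (aFixed m) R))

  twoLevelSum-levelSum : ∀ F → twoLevelSum F ≡ levelSum (foldWeight m F)
  twoLevelSum-levelSum F = begin
      twoLevelSum F
    ≡⟨ sumSubsets-cong (length W) (λ X₁ → sumSubsets-cong (length W) (λ X₂ → sum-X₃ F X₁ X₂)) ⟩
      sumSubsets (length W) (λ X₁ → sumSubsets (length W) (λ X₂ → pinnedTerm F X₁ X₂))
    ≡⟨ sumSubsets-cong (length W) (λ X₁ → sumSubsets-interleave (moves a) W (pinnedTerm F X₁)) ⟩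
      sumSubsets (length W) (λ X₁ → sumSubsets (length M) (λ P → sumSubsets (length (aFixed m)) (λ R →
        pinnedTerm F X₁ (interleave (moves a) W P R))))
    ≡⟨ sumSubsets-cong (length W) (λ X₁ → sumSubsets-cong (length M) (λ P → sumSubsets-cong (length (aFixed m)) (λ R →
         cong₂ (λ c z → if c then F (countAll W X₁) (z + z) else 0)
               (pinnedᵇ-interleave X₁ P R) (countAll-interleave-aFixed P R)))) ⟩
      sumSubsets (length W) (λ X₁ → sumSubsets (length M) (λ P → sumSubsets (length (aFixed m)) (λ R →
        if closedᵇ P X₁ then F (countAll W X₁) ((countAll M P + size R) + (countAll M P + size R)) else 0)))
    ≡⟨ sumSubsets-swap (length W) (length M) _ ⟩
      sumSubsets (length M) (λ P → sumSubsets (length W) (λ X₁ → sumSubsets (length (aFixed m)) (λ R →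
        if closedᵇ P X₁ then F (countAll W X₁) ((countAll M P + size R) + (countAll M P + size R)) else 0)))
    ≡⟨ sumSubsets-cong (length M) (λ P → sumSubsets-cong (length W) (λ X₁ →
         sym (if-sumSubsets (length (aFixed m)) (closedᵇ P X₁) _))) ⟩
      levelSum (foldWeight m F) ∎
    where open ≡-Reasoning

polygonSum-edges-suc-suc : ∀ m F → polygonSum (edges (suc (suc m))) F ≡ polygonSum (edges (suc m)) (foldWeight m F)
polygonSum-edges-suc-suc m F =
  trans (TwoLevels.polygonSum-twoLevelSum m F)
        (trans (Reduction.twoLevelSum-levelSum m F) (sym (OneLevel.polygonSum-levelSum m (foldWeight m F))))

module _ {n : ℕ} (L : List (Edge n)) where

  polygonSum-cong : ∀ {F G : ℕ → ℕ → ℕ} → (∀ p q → F p q ≡ G p q) → polygonSum L F ≡ polygonSum L G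
  polygonSum-cong F≡G = sumSubsets-cong (length L) (λ X → cong (λ z → if isClosedIn L X then z else 0) (F≡G _ _))

  polygonSum-+ : ∀ (F G : ℕ → ℕ → ℕ) → polygonSum L (λ p q → F p q + G p q) ≡ polygonSum L F + polygonSum L G
  polygonSum-+ F G = trans (sumSubsets-cong (length L) (λ X → if-+ (isClosedIn L X) _ _)) (sumSubsets-+ (length L) _ _)
    where
    if-+ : ∀ c x y → (if c then x + y else 0) ≡ (if c then x else 0) + (if c then y else 0)
    if-+ true  x y = refl
    if-+ false x y = refl

  polygonSum-* : ∀ k (F : ℕ → ℕ → ℕ) → polygonSum L (λ p q → k * F p q) ≡ k * polygonSum L F
  polygonSum-* k F = trans (sumSubsets-cong (length L) (λ X → if-* (isClosedIn L X) _)) (sumSubsets-* (length L) k _)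
    where
    if-* : ∀ c x → (if c then k * x else 0) ≡ k * (if c then x else 0)
    if-* true  x = refl
    if-* false x = sym (*-zeroʳ k)

subsetCount sizeSum sizeSquareSum : ℕ → ℕ
subsetCount   r = sumSubsets r (λ _ → 1)
sizeSum       r = sumSubsets r size
sizeSquareSum r = sumSubsets r (λ R → size R * size R)

sumSubsets-const : ∀ r k → sumSubsets r (λ _ → k) ≡ k * subsetCount r
sumSubsets-const r k = trans (sumSubsets-cong r (λ _ → sym (*-identityʳ k))) (sumSubsets-* r k (λ _ → 1))

subsetCount-nonzero : ∀ r → ∃ λ t → subsetCount r ≡ suc t
subsetCount-nonzero zero    = 0 , refl
subsetCount-nonzero (suc r) with subsetCount r | subsetCount-nonzero r
... | _ | t , refl = t + suc t , refl

sizeSum-suc : ∀ r → sizeSum (suc r) ≡ sizeSum r + (subsetCount r + sizeSum r)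
sizeSum-suc r = cong (sizeSum r +_) (sumSubsets-+ r (λ _ → 1) size)

sizeSquareSum-suc : ∀ r → sizeSquareSum (suc r) ≡ sizeSquareSum r + (subsetCount r + (2 * sizeSum r + sizeSquareSum r))
sizeSquareSum-suc r = cong (sizeSquareSum r +_) (begin
    sumSubsets r (λ R → (1 + size R) * (1 + size R))
  ≡⟨ sumSubsets-cong r (λ R → square-suc (size R)) ⟩
    sumSubsets r (λ R → 1 + (2 * size R + size R * size R))
  ≡⟨ sumSubsets-+ r (λ _ → 1) _ ⟩
    subsetCount r + sumSubsets r (λ R → 2 * size R + size R * size R)
  ≡⟨ cong (subsetCount r +_) (sumSubsets-+ r (λ R → 2 * size R) _) ⟩
    subsetCount r + (sumSubsets r (λ R → 2 * size R) + sizeSquareSum r)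
  ≡⟨ cong (λ z → subsetCount r + (z + sizeSquareSum r)) (sumSubsets-* r 2 size) ⟩
    subsetCount r + (2 * sizeSum r + sizeSquareSum r) ∎)
  where
  open ≡-Reasoning
  square-suc : ∀ o → (1 + o) * (1 + o) ≡ 1 + (2 * o + o * o)
  square-suc = solve-∀

sizeSum-closed : ∀ r → 2 * sizeSum r ≡ r * subsetCount r
sizeSum-closed zero    = refl
sizeSum-closed (suc r) = begin
    2 * sizeSum (suc r)
  ≡⟨ cong (2 *_) (sizeSum-suc r) ⟩
    2 * (sizeSum r + (subsetCount r + sizeSum r))
  ≡⟨ expand (sizeSum r) (subsetCount r) ⟩
    2 * sizeSum r + 2 * subsetCount r + 2 * sizeSum r
  ≡⟨ cong (λ z → z + 2 * subsetCount r + z) (sizeSum-closed r) ⟩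
    r * subsetCount r + 2 * subsetCount r + r * subsetCount r
  ≡⟨ collect r (subsetCount r) ⟩
    suc r * (subsetCount r + subsetCount r) ∎
  where
  open ≡-Reasoning
  expand : ∀ p q → 2 * (p + (q + p)) ≡ 2 * p + 2 * q + 2 * p
  expand = solve-∀
  collect : ∀ r q → r * q + 2 * q + r * q ≡ suc r * (q + q)
  collect = solve-∀

sizeSquareSum-closed : ∀ r → 4 * sizeSquareSum r ≡ r * (r + 1) * subsetCount r
sizeSquareSum-closed zero    = refl
sizeSquareSum-closed (suc r) = begin
    4 * sizeSquareSum (suc r)
  ≡⟨ cong (4 *_) (sizeSquareSum-suc r) ⟩
    4 * (sizeSquareSum r + (subsetCount r + (2 * sizeSum r + sizeSquareSum r)))
  ≡⟨ expand (sizeSquareSum r) (subsetCount r) (sizeSum r) ⟩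
    4 * sizeSquareSum r + 4 * subsetCount r + 4 * (2 * sizeSum r) + 4 * sizeSquareSum r
  ≡⟨ cong₂ (λ z w → z + 4 * subsetCount r + 4 * w + z) (sizeSquareSum-closed r) (sizeSum-closed r) ⟩
    r * (r + 1) * subsetCount r + 4 * subsetCount r + 4 * (r * subsetCount r) + r * (r + 1) * subsetCount r
  ≡⟨ collect r (subsetCount r) ⟩
    suc r * (suc r + 1) * (subsetCount r + subsetCount r) ∎
  where
  open ≡-Reasoning
  expand : ∀ p q s → 4 * (p + (q + (2 * s + p))) ≡ 4 * p + 4 * q + 4 * (2 * s) + 4 * p
  expand = solve-∀
  collect : ∀ r q → r * (r + 1) * q + 4 * q + 4 * (r * q) + r * (r + 1) * q ≡ suc r * (suc r + 1) * (q + q)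
  collect = solve-∀

polygons sumA sumA² sumB sumB² : ℕ → ℕ
polygons n = polygonSum (edges n) (λ _ _ → 1)
sumA     n = polygonSum (edges n) (λ p _ → p)
sumA²    n = polygonSum (edges n) (λ p _ → p * p)
sumB     n = polygonSum (edges n) (λ _ q → q)
sumB²    n = polygonSum (edges n) (λ _ q → q * q)

polygonSum-linear : ∀ {n} (L : List (Edge n)) k l (F G : ℕ → ℕ → ℕ) →
  polygonSum L (λ p q → k * F p q + l * G p q) ≡ k * polygonSum L F + l * polygonSum L G
polygonSum-linear L k l F G =
  trans (polygonSum-+ L (λ p q → k * F p q) (λ p q → l * G p q)) (cong₂ _+_ (polygonSum-* L k F) (polygonSum-* L l G))

sumSubsets-shift : ∀ r p → sumSubsets r (λ R → (p + size R) + (p + size R))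
                           ≡ (2 * subsetCount r) * p + (2 * sizeSum r) * 1
sumSubsets-shift r p = begin
    sumSubsets r (λ R → (p + size R) + (p + size R))
  ≡⟨ sumSubsets-cong r (λ R → expand p (size R)) ⟩
    sumSubsets r (λ R → 2 * p + 2 * size R)
  ≡⟨ sumSubsets-+ r (λ _ → 2 * p) (λ R → 2 * size R) ⟩
    sumSubsets r (λ _ → 2 * p) + sumSubsets r (λ R → 2 * size R)
  ≡⟨ cong₂ _+_ (sumSubsets-const r (2 * p)) (sumSubsets-* r 2 size) ⟩
    2 * p * subsetCount r + 2 * sizeSum r
  ≡⟨ collect p (subsetCount r) (sizeSum r) ⟩
    (2 * subsetCount r) * p + (2 * sizeSum r) * 1 ∎
  where
  open ≡-Reasoning
  expand : ∀ p o → (p + o) + (p + o) ≡ 2 * p + 2 * o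
  expand = solve-∀
  collect : ∀ p x y → 2 * p * x + 2 * y ≡ (2 * x) * p + (2 * y) * 1
  collect = solve-∀

sumSubsets-shift² : ∀ r p → sumSubsets r (λ R → ((p + size R) + (p + size R)) * ((p + size R) + (p + size R)))
                            ≡ ((4 * subsetCount r) * (p * p) + (8 * sizeSum r) * p) + (4 * sizeSquareSum r) * 1
sumSubsets-shift² r p = begin
    sumSubsets r (λ R → ((p + size R) + (p + size R)) * ((p + size R) + (p + size R)))
  ≡⟨ sumSubsets-cong r (λ R → expand p (size R)) ⟩
    sumSubsets r (λ R → (4 * (p * p) + (8 * p) * size R) + 4 * (size R * size R))
  ≡⟨ sumSubsets-+ r (λ R → 4 * (p * p) + (8 * p) * size R) (λ R → 4 * (size R * size R)) ⟩
    sumSubsets r (λ R → 4 * (p * p) + (8 * p) * size R) + sumSubsets r (λ R → 4 * (size R * size R))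
  ≡⟨ cong₂ _+_ (sumSubsets-+ r (λ _ → 4 * (p * p)) (λ R → (8 * p) * size R))
               (sumSubsets-* r 4 (λ R → size R * size R)) ⟩
    (sumSubsets r (λ _ → 4 * (p * p)) + sumSubsets r (λ R → (8 * p) * size R)) + 4 * sizeSquareSum r
  ≡⟨ cong (λ z → z + 4 * sizeSquareSum r)
          (cong₂ _+_ (sumSubsets-const r (4 * (p * p))) (sumSubsets-* r (8 * p) size)) ⟩
    (4 * (p * p) * subsetCount r + 8 * p * sizeSum r) + 4 * sizeSquareSum r
  ≡⟨ collect p (subsetCount r) (sizeSum r) (sizeSquareSum r) ⟩
    ((4 * subsetCount r) * (p * p) + (8 * sizeSum r) * p) + (4 * sizeSquareSum r) * 1 ∎
  where
  open ≡-Reasoning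
  expand : ∀ p o → ((p + o) + (p + o)) * ((p + o) + (p + o)) ≡ (4 * (p * p) + (8 * p) * o) + 4 * (o * o)
  expand = solve-∀
  collect : ∀ p x y z → (4 * (p * p) * x + 8 * p * y) + 4 * z ≡ ((4 * x) * (p * p) + (8 * y) * p) + (4 * z) * 1
  collect = solve-∀

module MomentRecurrences (m : ℕ) where

  r : ℕ
  r = length (aFixed m)

  polygonSum-aWeight : ∀ (G : ℕ → ℕ) →
    polygonSum (edges (suc (suc m))) (λ p _ → G p) ≡ subsetCount r * polygonSum (edges (suc m)) (λ _ q → G q)
  polygonSum-aWeight G =
    trans (polygonSum-edges-suc-suc m (λ p _ → G p))
          (trans (polygonSum-cong (edges (suc m)) (λ _ q → trans (sumSubsets-const r (G q)) (*-comm (G q) _)))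
                 (polygonSum-* (edges (suc m)) (subsetCount r) (λ _ q → G q)))

  polygons-rec : polygons (suc (suc m)) ≡ subsetCount r * polygons (suc m)
  polygons-rec = polygonSum-aWeight (λ _ → 1)

  sumA-rec : sumA (suc (suc m)) ≡ subsetCount r * sumB (suc m)
  sumA-rec = polygonSum-aWeight (λ p → p)

  sumA²-rec : sumA² (suc (suc m)) ≡ subsetCount r * sumB² (suc m)
  sumA²-rec = polygonSum-aWeight (λ p → p * p)

  sumB-rec : sumB (suc (suc m)) ≡ (2 * subsetCount r) * sumA (suc m) + (2 * sizeSum r) * polygons (suc m)
  sumB-rec =
    trans (polygonSum-edges-suc-suc m (λ _ q → q))
          (trans (polygonSum-cong (edges (suc m)) (λ p _ → sumSubsets-shift r p))
                 (polygonSum-linear (edges (suc m)) (2 * subsetCount r) (2 * sizeSum r) (λ p _ → p) (λ _ _ → 1)))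

  sumB²-rec : sumB² (suc (suc m))
              ≡ ((4 * subsetCount r) * sumA² (suc m) + (8 * sizeSum r) * sumA (suc m))
                + (4 * sizeSquareSum r) * polygons (suc m)
  sumB²-rec =
    trans (polygonSum-edges-suc-suc m (λ _ q → q * q))
          (trans (polygonSum-cong (edges (suc m)) (λ p _ → sumSubsets-shift² r p))
                 (trans (polygonSum-+ (edges (suc m)) (λ p _ → (4 * subsetCount r) * (p * p) + (8 * sizeSum r) * p)
                                                      (λ _ _ → (4 * sizeSquareSum r) * 1))
                        (cong₂ _+_ (polygonSum-linear (edges (suc m)) (4 * subsetCount r) (8 * sizeSum r)
                                                      (λ p _ → p * p) (λ p _ → p))
                                   (polygonSum-* (edges (suc m)) (4 * sizeSquareSum r) (λ _ _ → 1)))))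

-- With x = 2^L, the a-count has mean x/4 and variance α x/16, the b-count mean x/2 and variance β x/8.
MomentLaw : ℕ → ℕ → ℕ → Set
MomentLaw L α β =
    (4 * sumA L ≡ polygons L * x) × (2 * sumB L ≡ polygons L * x)
  × (16 * sumA² L ≡ polygons L * (x * x + α * x)) × (8 * sumB² L ≡ polygons L * (2 * (x * x) + β * x))
  × ∃ λ t → polygons L ≡ suc t
  where x = 2 ^ L

momentLaw-2 : MomentLaw 2 4 4
momentLaw-2 = refl , refl , refl , refl , 7 , refl

step-sumA : ∀ N b₁ c₀ x → 2 * b₁ ≡ N * x → 4 * (c₀ * b₁) ≡ (c₀ * N) * (2 * x)
step-sumA N b₁ c₀ x 2b₁≡Nx = begin
    4 * (c₀ * b₁)       ≡⟨ l₁ c₀ b₁ ⟩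
    c₀ * (2 * (2 * b₁)) ≡⟨ cong (λ z → c₀ * (2 * z)) 2b₁≡Nx ⟩
    c₀ * (2 * (N * x))  ≡⟨ l₂ c₀ N x ⟩
    (c₀ * N) * (2 * x)  ∎
  where
  open ≡-Reasoning
  l₁ : ∀ c y → 4 * (c * y) ≡ c * (2 * (2 * y))
  l₁ = solve-∀
  l₂ : ∀ c N x → c * (2 * (N * x)) ≡ (c * N) * (2 * x)
  l₂ = solve-∀

step-sumB : ∀ N a₁ c₀ c₁ r x → 4 * a₁ ≡ N * x → 2 * c₁ ≡ r * c₀ → 2 * r ≡ x →
            2 * ((2 * c₀) * a₁ + (2 * c₁) * N) ≡ (c₀ * N) * (2 * x)
step-sumB N a₁ c₀ c₁ r x 4a₁≡Nx 2c₁≡rc₀ refl = begin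
    2 * ((2 * c₀) * a₁ + (2 * c₁) * N)       ≡⟨ l₁ N a₁ c₀ c₁ ⟩
    c₀ * (4 * a₁) + 2 * N * (2 * c₁)         ≡⟨ cong₂ (λ z w → c₀ * z + 2 * N * w) 4a₁≡Nx 2c₁≡rc₀ ⟩
    c₀ * (N * (2 * r)) + 2 * N * (r * c₀)    ≡⟨ l₂ N c₀ r ⟩
    (c₀ * N) * (2 * (2 * r))                 ∎
  where
  open ≡-Reasoning
  l₁ : ∀ N y c₀ c₁ → 2 * ((2 * c₀) * y + (2 * c₁) * N) ≡ c₀ * (4 * y) + 2 * N * (2 * c₁)
  l₁ = solve-∀
  l₂ : ∀ N c₀ r → c₀ * (N * (2 * r)) + 2 * N * (r * c₀) ≡ (c₀ * N) * (2 * (2 * r))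
  l₂ = solve-∀

step-sumA² : ∀ N b₂ c₀ β x → 8 * b₂ ≡ N * (2 * (x * x) + β * x) →
             16 * (c₀ * b₂) ≡ (c₀ * N) * ((2 * x) * (2 * x) + β * (2 * x))
step-sumA² N b₂ c₀ β x law = begin
    16 * (c₀ * b₂)                                 ≡⟨ l₁ c₀ b₂ ⟩
    2 * c₀ * (8 * b₂)                              ≡⟨ cong (2 * c₀ *_) law ⟩
    2 * c₀ * (N * (2 * (x * x) + β * x))           ≡⟨ l₂ N c₀ β x ⟩
    (c₀ * N) * ((2 * x) * (2 * x) + β * (2 * x))   ∎
  where
  open ≡-Reasoning
  l₁ : ∀ c y → 16 * (c * y) ≡ 2 * c * (8 * y)
  l₁ = solve-∀
  l₂ : ∀ N c β x → 2 * c * (N * (2 * (x * x) + β * x)) ≡ (c * N) * ((2 * x) * (2 * x) + β * (2 * x))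
  l₂ = solve-∀

step-sumB² : ∀ N a₁ a₂ c₀ c₁ c₂ r α x → 16 * a₂ ≡ N * (x * x + α * x) → 4 * a₁ ≡ N * x →
             2 * c₁ ≡ r * c₀ → 4 * c₂ ≡ r * (r + 1) * c₀ → 2 * r ≡ x →
  8 * (((4 * c₀) * a₂ + (8 * c₁) * a₁) + (4 * c₂) * N) ≡ (c₀ * N) * (2 * ((2 * x) * (2 * x)) + (2 + α) * (2 * x))
step-sumB² N a₁ a₂ c₀ c₁ c₂ r α x lawA² lawA 2c₁≡rc₀ 4c₂≡r[r+1]c₀ refl = begin
    8 * (((4 * c₀) * a₂ + (8 * c₁) * a₁) + (4 * c₂) * N)
  ≡⟨ l₁ N a₁ a₂ c₀ c₁ c₂ ⟩
    2 * c₀ * (16 * a₂) + 8 * (2 * c₁) * (4 * a₁) + 8 * N * (4 * c₂)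
  ≡⟨ cong₂ (λ z w → 2 * c₀ * z + w + 8 * N * (4 * c₂)) lawA² (cong₂ (λ z w → 8 * z * w) 2c₁≡rc₀ lawA) ⟩
    2 * c₀ * (N * (x′ * x′ + α * x′)) + 8 * (r * c₀) * (N * x′) + 8 * N * (4 * c₂)
  ≡⟨ cong (λ z → 2 * c₀ * (N * (x′ * x′ + α * x′)) + 8 * (r * c₀) * (N * x′) + 8 * N * z) 4c₂≡r[r+1]c₀ ⟩
    2 * c₀ * (N * (x′ * x′ + α * x′)) + 8 * (r * c₀) * (N * x′) + 8 * N * (r * (r + 1) * c₀)
  ≡⟨ l₂ N c₀ r α ⟩
    (c₀ * N) * (2 * ((2 * x′) * (2 * x′)) + (2 + α) * (2 * x′)) ∎
  where
  open ≡-Reasoning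
  x′ = 2 * r
  l₁ : ∀ N y y₂ c₀ c₁ c₂ → 8 * (((4 * c₀) * y₂ + (8 * c₁) * y) + (4 * c₂) * N)
                           ≡ 2 * c₀ * (16 * y₂) + 8 * (2 * c₁) * (4 * y) + 8 * N * (4 * c₂)
  l₁ = solve-∀
  l₂ : ∀ N c₀ r α → 2 * c₀ * (N * ((2 * r) * (2 * r) + α * (2 * r))) + 8 * (r * c₀) * (N * (2 * r))
                      + 8 * N * (r * (r + 1) * c₀)
                    ≡ (c₀ * N) * (2 * ((2 * (2 * r)) * (2 * (2 * r))) + (2 + α) * (2 * (2 * r)))
  l₂ = solve-∀

momentLaw-step : ∀ m α β → 2 * length (aFixed m) ≡ 2 ^ suc m → MomentLaw (suc m) α β →
                 MomentLaw (suc (suc m)) β (2 + α)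
momentLaw-step m α β 2r≡x (lawA , lawB , lawA² , lawB² , t , N≡1+t) =
  trans (cong (4 *_) sumA-rec) (trans (step-sumA N (sumB (suc m)) c₀ x lawB) (cong (_* (2 * x)) (sym polygons-rec))) ,
  trans (cong (2 *_) sumB-rec)
        (trans (step-sumB N (sumA (suc m)) c₀ (sizeSum r) r x lawA (sizeSum-closed r) 2r≡x)
               (cong (_* (2 * x)) (sym polygons-rec))) ,
  trans (cong (16 *_) sumA²-rec)
        (trans (step-sumA² N (sumB² (suc m)) c₀ β x lawB²)
               (cong (_* ((2 * x) * (2 * x) + β * (2 * x))) (sym polygons-rec))) ,
  trans (cong (8 *_) sumB²-rec)
        (trans (step-sumB² N (sumA (suc m)) (sumA² (suc m)) c₀ (sizeSum r) (sizeSquareSum r) r α x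
                           lawA² lawA (sizeSum-closed r) (sizeSquareSum-closed r) 2r≡x)
               (cong (_* (2 * ((2 * x) * (2 * x)) + (2 + α) * (2 * x))) (sym polygons-rec))) ,
  nonzero
  where
  open MomentRecurrences m
  N = polygons (suc m)
  x = 2 ^ suc m
  c₀ = subsetCount r
  nonzero : ∃ λ t → polygons (suc (suc m)) ≡ suc t
  nonzero with subsetCount-nonzero r
  ... | t₀ , c₀≡1+t₀ = t + t₀ * suc t , trans polygons-rec (cong₂ _*_ c₀≡1+t₀ N≡1+t)

length-allWords : ∀ n → length (allWords n) ≡ 2 ^ n
length-allWords zero    = refl
length-allWords (suc n) =
  trans (length-++ (map (false ∷_) W))
        (cong₂ _+_ (trans (length-map _ W) (length-allWords n))
                   (trans (trans (length-map _ W) (length-allWords n)) (sym (+-identityʳ (2 ^ n)))))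
  where W = allWords n

aFixed-suc : ∀ m → aFixed (suc m) ≡ map (true ∷_) (allWords (suc m))
aFixed-suc m = trans (filterWords-allWords-suc (not ∘ moves a))
  (cong₂ (λ p q → map (false ∷_) p ++ map (true ∷_) q)
         (filterWords-none _ W (λ u → cong not (moves-b u)))
         (filterWords-all _ W (λ u → cong not (moves-a-true u))))
  where W = allWords (suc m)

length-aFixed : ∀ m → 2 * length (aFixed (suc m)) ≡ 2 ^ suc (suc m)
length-aFixed m =
  cong (2 *_) (trans (cong length (aFixed-suc m)) (trans (length-map _ (allWords (suc m))) (length-allWords (suc m))))

double : ℕ → ℕ
double zero    = zero
double (suc i) = suc (suc (double i))

momentLaw-even : ∀ i → MomentLaw (2 + double i) (4 + double i) (4 + double i)
momentLaw-odd  : ∀ i → MomentLaw (3 + double i) (4 + double i) (6 + double i)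
momentLaw-even zero    = momentLaw-2
momentLaw-even (suc i) =
  momentLaw-step (2 + double i) (4 + double i) (6 + double i) (length-aFixed (suc (double i))) (momentLaw-odd i)
momentLaw-odd  i       =
  momentLaw-step (1 + double i) (4 + double i) (4 + double i) (length-aFixed (double i)) (momentLaw-even i)

sum-filter : ∀ {A : Set} {P : A → Set} (P? : Decidable P) (f : A → ℕ) (xs : List A) →
  sum (map f (filter P? xs)) ≡ sum (map (λ x → if does (P? x) then f x else 0) xs)
sum-filter P? f []       = refl
sum-filter P? f (x ∷ xs) with does (P? x)
... | true  = cong (f x +_) (sum-filter P? f xs)
... | false = sum-filter P? f xs

length-as-sum : ∀ {A : Set} (xs : List A) → length xs ≡ sum (map (λ _ → 1) xs)
length-as-sum []       = refl
length-as-sum (x ∷ xs) = cong suc (length-as-sum xs)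

module _ (n : ℕ) where

  sum-closedPolygons : ∀ (f : EdgeSubset n → ℕ) → sum (map f (closedPolygons n))
    ≡ sumSubsets (length (edges n)) (λ X → if does (isClosedPolygon? {n} X) then f X else 0)
  sum-closedPolygons f = trans (sum-filter (isClosedPolygon? {n}) f (allWords (length (edges n))))
                               (sum-allWords (length (edges n)) _)

  length-labelCounts : ∀ w → length (map (labelCount {n} w) (closedPolygons n)) ≡ polygons n
  length-labelCounts w = trans (length-map _ (closedPolygons n))
                               (trans (length-as-sum (closedPolygons n)) (sum-closedPolygons (λ _ → 1)))

  sum-labelCounts² : ∀ w → sum (map (λ y → y * y) (map (labelCount {n} w) (closedPolygons n)))
                         ≡ sumSubsets (length (edges n)) (λ X →
                             if does (isClosedPolygon? {n} X) then labelCount {n} w X * labelCount {n} w X else 0)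
  sum-labelCounts² w = trans (cong sum (sym (map-∘ (closedPolygons n)))) (sum-closedPolygons _)

ℕtoℚ-/ : ∀ t k S → S ≡ suc t * k → (ℤ.+ S) ℚ./ suc t ≡ ℕtoℚ k
ℕtoℚ-/ t k S S≡[1+t]k = ℚ.fromℚᵘ-cong {ℚᵘ.mkℚᵘ (ℤ.+ S) t} {ℚᵘ.mkℚᵘ (ℤ.+ k) 0}
  (ℚᵘ.*≡* (trans (sym (ℤ.pos-* S 1)) (trans (cong ℤ.+_ cross) (ℤ.pos-* k (suc t)))))
  where
  cross : S * 1 ≡ k * suc t
  cross = trans (*-identityʳ S) (trans S≡[1+t]k (*-comm (suc t) k))

toℚᵘ-ℕtoℚ : ∀ k → ℚ.toℚᵘ (ℕtoℚ k) ℚᵘ.≃ ℚᵘ.mkℚᵘ (ℤ.+ k) 0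
toℚᵘ-ℕtoℚ k = ℚ.toℚᵘ-fromℚᵘ (ℚᵘ.mkℚᵘ (ℤ.+ k) 0)

ℕtoℚ-* : ∀ x y → ℕtoℚ x ℚ.* ℕtoℚ y ≡ ℕtoℚ (x * y)
ℕtoℚ-* x y = ℚ.toℚᵘ-injective (begin
    ℚ.toℚᵘ (ℕtoℚ x ℚ.* ℕtoℚ y)                 ≈⟨ ℚ.toℚᵘ-homo-* (ℕtoℚ x) (ℕtoℚ y) ⟩
    ℚ.toℚᵘ (ℕtoℚ x) ℚᵘ.* ℚ.toℚᵘ (ℕtoℚ y)       ≈⟨ ℚᵘ.*-cong (toℚᵘ-ℕtoℚ x) (toℚᵘ-ℕtoℚ y) ⟩
    ℚᵘ.mkℚᵘ (ℤ.+ x) 0 ℚᵘ.* ℚᵘ.mkℚᵘ (ℤ.+ y) 0   ≈⟨ ℚᵘ.*≡* (cong (ℤ._* ℤ.1ℤ) (sym (ℤ.pos-* x y))) ⟩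
    ℚᵘ.mkℚᵘ (ℤ.+ (x * y)) 0                    ≈⟨ toℚᵘ-ℕtoℚ (x * y) ⟨
    ℚ.toℚᵘ (ℕtoℚ (x * y))                      ∎)
  where open ℚᵘ.≃-Reasoning

ℕtoℚ-+-cancel : ∀ k v → ℕtoℚ (k + v) ℚ.- ℕtoℚ k ≡ ℕtoℚ v
ℕtoℚ-+-cancel k v = ℚ.toℚᵘ-injective (begin
    ℚ.toℚᵘ (ℕtoℚ (k + v) ℚ.- ℕtoℚ k)
  ≈⟨ ℚ.toℚᵘ-homo-+ (ℕtoℚ (k + v)) (ℚ.- ℕtoℚ k) ⟩
    ℚ.toℚᵘ (ℕtoℚ (k + v)) ℚᵘ.+ ℚ.toℚᵘ (ℚ.- ℕtoℚ k)
  ≈⟨ ℚᵘ.+-cong (toℚᵘ-ℕtoℚ (k + v)) (ℚᵘ.≃-trans (ℚ.toℚᵘ-homo‿- (ℕtoℚ k)) (ℚᵘ.-‿cong (toℚᵘ-ℕtoℚ k))) ⟩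
    ℚᵘ.mkℚᵘ (ℤ.+ (k + v)) 0 ℚᵘ.- ℚᵘ.mkℚᵘ (ℤ.+ k) 0
  ≈⟨ ℚᵘ.*≡* (trans (cong (λ z → (z ℤ.* ℤ.1ℤ ℤ.+ (ℤ.- (ℤ.+ k)) ℤ.* ℤ.1ℤ) ℤ.* ℤ.1ℤ) (ℤ.pos-+ k v))
                   (cancel (ℤ.+ k) (ℤ.+ v))) ⟩
    ℚᵘ.mkℚᵘ (ℤ.+ v) 0
  ≈⟨ toℚᵘ-ℕtoℚ v ⟨
    ℚ.toℚᵘ (ℕtoℚ v) ∎)
  where
  open ℚᵘ.≃-Reasoning
  cancel : ∀ (p q : ℤ.ℤ) → ((p ℤ.+ q) ℤ.* ℤ.1ℤ ℤ.+ (ℤ.- p) ℤ.* ℤ.1ℤ) ℤ.* ℤ.1ℤ ≡ q ℤ.* ℤ.1ℤ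
  cancel = ℤ.solve-∀

average-≡ : ∀ (ys : List ℕ) t k → length ys ≡ suc t → sum ys ≡ suc t * k → average ys ≡ ℕtoℚ k
average-≡ (y ∷ ys) t k len≡ sum≡ =
  trans (cong (λ d → (ℤ.+ sum (y ∷ ys)) ℚ./ suc d) (suc-injective len≡)) (ℕtoℚ-/ t k _ sum≡)

variance-≡ : ∀ (ys : List ℕ) t μ v → length ys ≡ suc t → sum ys ≡ suc t * μ →
             sum (map (λ y → y * y) ys) ≡ suc t * (μ * μ + v) → variance ys ≡ ℕtoℚ v
variance-≡ ys t μ v len≡ sum≡ sum²≡ =
  trans (cong₂ ℚ._-_ (average-≡ (map (λ y → y * y) ys) t (μ * μ + v) (trans (length-map _ ys) len≡) sum²≡)
                     (trans (cong₂ ℚ._*_ (average-≡ ys t μ len≡ sum≡) (average-≡ ys t μ len≡ sum≡))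
                            (ℕtoℚ-* μ μ)))
        (ℕtoℚ-+-cancel (μ * μ) v)

moments : ∀ k α β → MomentLaw (4 + k) α β →
    (μ (4 + k) a ≡ ℕtoℚ (2 ^ (2 + k))) × (σ² (4 + k) a ≡ ℕtoℚ (α * 2 ^ k))
  × (μ (4 + k) b ≡ ℕtoℚ (2 ^ (3 + k))) × (σ² (4 + k) b ≡ ℕtoℚ (β * 2 ^ (1 + k)))
moments k α β (lawA , lawB , lawA² , lawB² , t , N≡1+t) =
  average-≡ (counts a) t _ (length≡ a) sumA≡ ,
  variance-≡ (counts a) t _ _ (length≡ a) sumA≡ (trans (sum-labelCounts² n a) sumA²≡) ,
  average-≡ (counts b) t _ (length≡ b) sumB≡ ,
  variance-≡ (counts b) t _ _ (length≡ b) sumB≡ (trans (sum-labelCounts² n b) sumB²≡)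
  where
  n = 4 + k
  y = 2 ^ k
  counts : Gen → List ℕ
  counts w = map (labelCount {n} w) (closedPolygons n)
  length≡ : ∀ w → length (counts w) ≡ suc t
  length≡ w = trans (length-labelCounts n w) N≡1+t
  -- 2 ^ n unfolds to 2 * (2 * (2 * (2 * y))).
  sumA≡ : sum (counts a) ≡ suc t * (2 * (2 * y))
  sumA≡ = trans (sum-closedPolygons n (labelCount {n} a))
                (*-cancelˡ-≡ _ _ 4 (trans lawA (trans (cong (_* 2 ^ n) N≡1+t) (l (suc t) y))))
    where
    l : ∀ N y → N * (2 * (2 * (2 * (2 * y)))) ≡ 4 * (N * (2 * (2 * y)))
    l = solve-∀
  sumB≡ : sum (counts b) ≡ suc t * (2 * (2 * (2 * y)))
  sumB≡ = trans (sum-closedPolygons n (labelCount {n} b))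
                (*-cancelˡ-≡ _ _ 2 (trans lawB (trans (cong (_* 2 ^ n) N≡1+t) (l (suc t) y))))
    where
    l : ∀ N y → N * (2 * (2 * (2 * (2 * y)))) ≡ 2 * (N * (2 * (2 * (2 * y))))
    l = solve-∀
  sumA²≡ : sumA² n ≡ suc t * ((2 * (2 * y)) * (2 * (2 * y)) + α * y)
  sumA²≡ = *-cancelˡ-≡ _ _ 16 (trans lawA² (trans (cong (_* (2 ^ n * 2 ^ n + α * 2 ^ n)) N≡1+t) (l (suc t) y α)))
    where
    l : ∀ N y α → N * ((2 * (2 * (2 * (2 * y)))) * (2 * (2 * (2 * (2 * y)))) + α * (2 * (2 * (2 * (2 * y)))))
                ≡ 16 * (N * ((2 * (2 * y)) * (2 * (2 * y)) + α * y))
    l = solve-∀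
  sumB²≡ : sumB² n ≡ suc t * ((2 * (2 * (2 * y))) * (2 * (2 * (2 * y))) + β * (2 * y))
  sumB²≡ = *-cancelˡ-≡ _ _ 8 (trans lawB² (trans (cong (_* (2 * (2 ^ n * 2 ^ n) + β * 2 ^ n)) N≡1+t) (l (suc t) y β)))
    where
    l : ∀ N y β → N * (2 * ((2 * (2 * (2 * (2 * y)))) * (2 * (2 * (2 * (2 * y))))) + β * (2 * (2 * (2 * (2 * y)))))
                ≡ 8 * (N * ((2 * (2 * (2 * y))) * (2 * (2 * (2 * y))) + β * (2 * y)))
    l = solve-∀

even⇒double : ∀ k → k % 2 ≡ 0 → ∃ λ i → k ≡ double i
even⇒double zero          _    = zero , refl
even⇒double (suc zero)    ()
even⇒double (suc (suc k)) even with even⇒double k even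
... | i , refl = suc i , refl

odd⇒double : ∀ k → k % 2 ≡ 1 → ∃ λ i → k ≡ suc (double i)
odd⇒double zero          ()
odd⇒double (suc zero)    _   = zero , refl
odd⇒double (suc (suc k)) odd with odd⇒double k odd
... | i , refl = suc i , refl

moments-odd : (n : ℕ) → 5 ≤ n → n % 2 ≡ 1 →
    (μ n a ≡ ℕtoℚ (2 ^ (n ∸ 2))) × (σ² n a ≡ ℕtoℚ ((n + 1) * 2 ^ (n ∸ 4)))
  × (μ n b ≡ ℕtoℚ (2 ^ (n ∸ 1))) × (σ² n b ≡ ℕtoℚ ((n + 3) * 2 ^ (n ∸ 3)))
moments-odd n@(suc (suc (suc (suc k)))) (s≤s (s≤s (s≤s (s≤s _)))) odd with odd⇒double k odd
... | i , refl = moments k (n + 1) (n + 3) (subst₂ (MomentLaw n) (+-comm 1 n) (+-comm 3 n) (momentLaw-odd (suc i)))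

moments-even : (n : ℕ) → 4 ≤ n → n % 2 ≡ 0 →
    (μ n a ≡ ℕtoℚ (2 ^ (n ∸ 2))) × (σ² n a ≡ ℕtoℚ ((n + 2) * 2 ^ (n ∸ 4)))
  × (μ n b ≡ ℕtoℚ (2 ^ (n ∸ 1))) × (σ² n b ≡ ℕtoℚ ((n + 2) * 2 ^ (n ∸ 3)))
moments-even n@(suc (suc (suc (suc k)))) (s≤s (s≤s (s≤s (s≤s _)))) even with even⇒double k even
... | i , refl = moments k (n + 2) (n + 2) (subst₂ (MomentLaw n) (+-comm 2 n) (+-comm 2 n) (momentLaw-even (suc i)))

mainTheorem13 : ((n : ℕ) → 5 ≤ n → n % 2 ≡ 1 →
                    (μ n a ≡ ℕtoℚ (2 ^ (n ∸ 2)))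
                  × (σ² n a ≡ ℕtoℚ ((n + 1) * 2 ^ (n ∸ 4)))
                  × (μ n b ≡ ℕtoℚ (2 ^ (n ∸ 1)))
                  × (σ² n b ≡ ℕtoℚ ((n + 3) * 2 ^ (n ∸ 3))))
                × ((n : ℕ) → 4 ≤ n → n % 2 ≡ 0 →
                    (μ n a ≡ ℕtoℚ (2 ^ (n ∸ 2)))
                  × (σ² n a ≡ ℕtoℚ ((n + 2) * 2 ^ (n ∸ 4)))
                  × (μ n b ≡ ℕtoℚ (2 ^ (n ∸ 1)))
                  × (σ² n b ≡ ℕtoℚ ((n + 2) * 2 ^ (n ∸ 3))))
mainTheorem13 = moments-odd , moments-even
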